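{- For $n\in\mathbb{N}$ and $k\in\{0,1,\dots,n\}$ define $q_{n,k}(x)$ by $x^nq_{n,k}(1/x)=\mathcal{A}^\circ(x^{n-k}(1+x)^k)$. Then: (a) $q_{n,k+1}(x)=q_{n,k}(x)+xq_{n-1,k}(x)$ for $0\le k<n$. (b) For $0\le k\le n$, $$q_{n,k}(x)=\sum_{i=0}^k\binom{k}{i}x^iA_{n-i}(x)=\sum_{w\in\mathfrak{S}_n}(1+x)^{\mathrm{fix}_k(w)}x^{\mathrm{exc}(w)}=\sum_{i=0}^k\binom{k}{i}p_{n-i,k-i}(x),$$ where $\mathrm{fix}_k(w)$ is the number of fixed points of $w\in\mathfrak{S}_n$ not exceeding $k$.
   Context: $\mathfrak{S}_n$ is the symmetric group on $[n]=\{1,\dots,n\}$. For $w\in\mathfrak{S}_n$, $\mathrm{des}(w)=\#\{i\in[n-1]:w(i)>w(i+1)\}$ and $\mathrm{exc}(w)=\#\{i\in[n]:w(i)>i\}$. The Eulerian polynomial is $A_n(x)=\sum_{w\in\mathfrak{S}_n}x^{\mathrm{des}(w)}=\sum_{w\in\mathfrak{S}_n}x^{\mathrm{exc}(w)}$, $A_0(x)=1$. The Eulerian transformation $\mathcal{A}^\circ:\mathbb{R}[x]\to\mathbb{R}[x]$ is linear with $\mathcal{A}^\circ(1)=1$ and $\mathcal{A}^\circ(x^m)=xA_m(x)$ for $m\ge1$. For $m\in\mathbb{N}$ and $j\in\{0,\dots,m\}$, $p_{m,j}(x)=\sum_{w\in\mathfrak{S}_{m+1}:\,w(1)=j+1}x^{\mathrm{des}(w)}$.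 -}

module Defs where

open import Data.Nat using (ℕ; zero; suc; _+_; _*_; _∸_; _<ᵇ_; _<?_)
open import Data.Nat.Combinatorics using (_C_)
open import Data.Fin using (Fin; toℕ) renaming (_≟_ to _≟ᶠ_)
open import Relation.Binary.PropositionalEquality using (_≡_)
open import Data.Vec using (Vec; []; _∷_; lookup; toList; allFin)
open import Data.List using (List; []; _∷_; [_]; map; concatMap; filter; foldr)
open import Data.Bool using (Bool; true; false; if_then_else_; _∧_)
open import Relation.Nullary using (does)
import Data.List.Relation.Unary.Unique.DecPropositional as UniqueDec
import Data.Vec.Functional as VF

-- Polynomials with natural-number coefficients, as little-endian
-- coefficient lists (c₀ ∷ c₁ ∷ …), compared coefficientwise.

Poly : Set
Poly = List ℕ

coeff : Poly → ℕ → ℕ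
coeff []       _       = 0
coeff (c ∷ _)  zero    = c
coeff (_ ∷ cs) (suc i) = coeff cs i

infix 4 _≈_
_≈_ : Poly → Poly → Set
p ≈ q = ∀ i → coeff p i ≡ coeff q i

infixl 6 _⊕_
_⊕_ : Poly → Poly → Poly
[]       ⊕ q        = q
p        ⊕ []       = p
(a ∷ p)  ⊕ (b ∷ q)  = (a + b) ∷ (p ⊕ q)

scale : ℕ → Poly → Poly
scale c = map (c *_)

infixl 7 _⊗_
_⊗_ : Poly → Poly → Poly
[]      ⊗ q = []
(a ∷ p) ⊗ q = scale a q ⊕ (0 ∷ (p ⊗ q))

one : Poly
one = 1 ∷ []

X : Poly
X = 0 ∷ 1 ∷ []

xpow : ℕ → Poly
xpow zero    = one
xpow (suc m) = X ⊗ xpow m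

ppow : Poly → ℕ → Poly
ppow p zero    = one
ppow p (suc m) = p ⊗ ppow p m

psum : List Poly → Poly
psum = foldr _⊕_ []

sumTo : ℕ → (ℕ → Poly) → Poly
sumTo zero    f = f 0
sumTo (suc k) f = sumTo k f ⊕ f (suc k)

-- The symmetric group 𝔖ₙ, in one-line notation with 0-based values:
-- w ∈ 𝔖ₙ is the vector (w(1)-1, …, w(n)-1) ∈ Fin n ^ n with distinct
-- entries.  perms n enumerates every element of 𝔖ₙ exactly once.

words : (n m : ℕ) → List (Vec (Fin m) n)
words zero    m = [ [] ]
words (suc n) m = concatMap (λ v → map (_∷ v) (toList (allFin m))) (words n m)

perms : (n : ℕ) → List (Vec (Fin n) n)
perms n = filter (λ v → UniqueDec.unique? _≟ᶠ_ (toList v)) (words n n)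

count : ∀ {n} → (Fin n → Bool) → ℕ
count {n} P = foldr (λ i r → (if P i then 1 else 0) + r) 0 (toList (allFin n))

desL : ∀ {m} → List (Fin m) → ℕ
desL []             = 0
desL (a ∷ [])       = 0
desL (a ∷ b ∷ rest) = (if toℕ b <ᵇ toℕ a then 1 else 0) + desL (b ∷ rest)

des : ∀ {n} → Vec (Fin n) n → ℕ
des w = desL (toList w)

exc : ∀ {n} → Vec (Fin n) n → ℕ
exc w = count (λ i → toℕ i <ᵇ toℕ (lookup w i))

-- fix_k(w) = #{ i ∈ [n] : w(i) = i, i ≤ k }   (0-based: toℕ i < k)
fixk : ∀ {n} → ℕ → Vec (Fin n) n → ℕ
fixk k w = count (λ i → does (lookup w i ≟ᶠ i) ∧ (toℕ i <ᵇ k))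

A : ℕ → Poly
A n = psum (map (λ w → xpow (des w)) (perms n))

-- Eulerian transformation: A°(1) = 1, A°(x^m) = x A_m(x) (m ≥ 1), linear.
Aᵒmono : ℕ → Poly
Aᵒmono zero    = one
Aᵒmono (suc m) = X ⊗ A (suc m)

Aᵒgo : ℕ → Poly → Poly
Aᵒgo m []       = []
Aᵒgo m (c ∷ cs) = scale c (Aᵒmono m) ⊕ Aᵒgo (suc m) cs

Aᵒ : Poly → Poly
Aᵒ = Aᵒgo 0

-- p_{m,j}(x) = Σ_{w ∈ 𝔖_{m+1}, w(1) = j+1} x^{des w}
p : ℕ → ℕ → Poly
p m j = psum (map (λ w → xpow (des w))
                  (filter (λ w → toℕ (lookup w Fin.zero) Data.Nat.≟ j) (perms (suc m))))
  where import Data.Nat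
        import Data.Fin as Fin

-- x^n P(1/x) for a polynomial P of degree ≤ n: coefficient list
-- (coeff P n, coeff P (n-1), …, coeff P 0).
revTo : ℕ → Poly → Poly
revTo n P = map (λ i → coeff P (n ∸ toℕ i)) (toList (allFin (suc n)))

q : ℕ → ℕ → Poly
q n k = revTo n (Aᵒ (xpow (n ∸ k) ⊗ ppow (1 ∷ 1 ∷ []) k))

-- Since x^{n-k-1} (1 + x)^{k+1} = x^{n-k} (1 + x)^k + x^{n-k-1} (1 + x)^k, linearity of A° gives
-- part (a); the second term has degree below n, so reversing it at degree n produces the factor x.
-- Recurrence (a) and the initial values q_{n,0} = A_n (palindromicity of A_n) determine q_{n,k} for
-- k ≤ n, so each formula of part (b) is proved by checking that it satisfies the same recurrence:
-- by Pascal's rule for the first; for the second by splitting off whether k is a fixed point and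
-- removing it, together with the equidistribution of exc and des for k = 0; for the third by Pascal's
-- rule and p_{m,j+1} + p_{m-1,j} = p_{m,j} + x p_{m-1,j}, which compares permutations by their first
-- letter. Both exc and des satisfy the recursion obtained by inserting a new largest value (into a
-- cycle, resp. into the word) and are therefore equidistributed.

module Submission where

open import Defs
open import Data.Nat using (ℕ; zero; suc; _+_; _*_; _∸_; _≤_; _<_; z≤n; s≤s; pred; _<ᵇ_; _≤?_)
  renaming (_≟_ to _≟ℕ_)
open import Data.Nat.Properties
open import Algebra.Properties.CommutativeSemigroup +-commutativeSemigroup using (interchange)
open import Data.Nat.Combinatorics using (_C_; nCk+nC[k+1]≡[n+1]C[k+1])
open import Data.Nat.Combinatorics.Specification using (k>n⇒nCk≡0)
open import Data.Bool using (Bool; true; false; if_then_else_; _∧_)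
open import Data.Bool.Properties using (∧-zeroʳ; ∧-identityʳ)
open import Data.List
  using (List; []; _∷_; [_]; _++_; map; length; filter; replicate; foldr; concatMap; cartesianProductWith)
import Data.List as List
import Data.List.Properties as List
open import Data.Fin using (Fin; toℕ)
import Data.Fin as Fin
import Data.Fin.Properties as Fin
open import Data.Vec using (Vec; []; _∷_; toList)
import Data.Vec as Vec
import Data.Vec.Properties as Vec
import Data.List.Relation.Unary.Unique.Propositional.Properties as Unique
import Data.List.Relation.Unary.Unique.DecPropositional as UniqueDec
open import Data.Product using (_×_; _,_; proj₂; uncurry)
open import Data.Unit using (tt)
open import Data.Sum using (inj₁; inj₂)
open import Data.List.Relation.Unary.All as All using (All; []; _∷_)
open import Data.List.Relation.Unary.Any as Any using (here; there)
open import Data.List.Relation.Unary.All.Properties using (¬Any⇒All¬) renaming (map⁺ to All-map⁺)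
open import Data.List.Properties using (length-map)
open import Data.List.Membership.DecPropositional _≟ℕ_ using (_∈?_)
open import Data.List.Relation.Unary.Unique.Propositional using (Unique)
open import Data.List.Relation.Unary.AllPairs using ([]; _∷_)
open import Data.List.Membership.Propositional using (_∈_)
open import Data.List.Membership.Propositional.Properties
  using (∈-map⁺; ∈-map⁻; ∈-filter⁺; ∈-filter⁻; ∈-allFin; ∈-cartesianProductWith⁺)
open import Data.List.Membership.Propositional.Properties.WithK using (unique∧set⇒bag)
open import Data.List.Relation.Binary.BagAndSetEquality using (∼bag⇒↭)
open import Data.List.Relation.Binary.Permutation.Propositional as ↭
  using (_↭_; ↭-refl; ↭-prep; ↭-swap; ↭-trans; ↭-sym)
open import Data.List.Relation.Binary.Permutation.Propositional.Properties
  using (All-resp-↭; ↭-length) renaming (map⁺ to ↭-map⁺)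
open import Data.Nat.ListAction using (sum)
open import Data.Nat.ListAction.Properties using (sum-↭)
open import Function using (_∘_; id)
open import Function.Bundles using (mk⇔)
open import Level using (0ℓ)
open import Relation.Nullary using (Dec; does; yes; no)
open import Relation.Nullary.Decidable using (dec-true; dec-false)
open import Data.Empty using (⊥-elim)
open import Relation.Unary using (Pred; Decidable)
open import Relation.Binary.Bundles using (Setoid)
import Relation.Binary.Reasoning.Setoid as SetoidReasoning
open import Relation.Binary.PropositionalEquality
  using (_≡_; _≢_; refl; sym; trans; cong; cong₂; subst; module ≡-Reasoning)

-- A record around _≈_, so that both polynomials can be inferred from a proof.
infix 4 _≋_
record _≋_ (P Q : Poly) : Set where
  constructor mk≋
  field at : P ≈ Q
open _≋_ public

≋-refl : ∀ {P} → P ≋ P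
≋-refl = mk≋ λ _ → refl

≋-sym : ∀ {P Q} → P ≋ Q → Q ≋ P
≋-sym e = mk≋ λ i → sym (at e i)

≋-trans : ∀ {P Q R} → P ≋ Q → Q ≋ R → P ≋ R
≋-trans e f = mk≋ λ i → trans (at e i) (at f i)

≡⇒≋ : ∀ {P Q} → P ≡ Q → P ≋ Q
≡⇒≋ refl = ≋-refl

≋-setoid : Setoid _ _
≋-setoid = record
  { Carrier = Poly ; _≈_ = _≋_
  ; isEquivalence = record { refl = ≋-refl ; sym = ≋-sym ; trans = ≋-trans } }

module ≋-Reasoning = SetoidReasoning ≋-setoid

coeff-⊕ : ∀ P Q i → coeff (P ⊕ Q) i ≡ coeff P i + coeff Q i
coeff-⊕ []      Q       i       = refl
coeff-⊕ (a ∷ P) []      i       = sym (+-identityʳ _)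
coeff-⊕ (a ∷ P) (b ∷ Q) zero    = refl
coeff-⊕ (a ∷ P) (b ∷ Q) (suc i) = coeff-⊕ P Q i

coeff-scale : ∀ c P i → coeff (scale c P) i ≡ c * coeff P i
coeff-scale c []      i       = sym (*-zeroʳ c)
coeff-scale c (a ∷ P) zero    = refl
coeff-scale c (a ∷ P) (suc i) = coeff-scale c P i

∷-cong : ∀ {a b P Q} → a ≡ b → P ≋ Q → a ∷ P ≋ b ∷ Q
∷-cong a≡b P≋Q = mk≋ λ { zero → a≡b ; (suc i) → at P≋Q i }

⊕-cong : ∀ {P P′ Q Q′} → P ≋ P′ → Q ≋ Q′ → P ⊕ Q ≋ P′ ⊕ Q′
⊕-cong {P} {P′} {Q} {Q′} e f = mk≋ λ i → begin
  coeff (P ⊕ Q) i          ≡⟨ coeff-⊕ P Q i ⟩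
  coeff P i + coeff Q i    ≡⟨ cong₂ _+_ (at e i) (at f i) ⟩
  coeff P′ i + coeff Q′ i  ≡⟨ coeff-⊕ P′ Q′ i ⟨
  coeff (P′ ⊕ Q′) i        ∎
  where open ≡-Reasoning

⊕-congʳ : ∀ P {Q Q′} → Q ≋ Q′ → P ⊕ Q ≋ P ⊕ Q′
⊕-congʳ P = ⊕-cong (≋-refl {P})

⊕-comm : ∀ P Q → P ⊕ Q ≋ Q ⊕ P
⊕-comm P Q = mk≋ λ i → begin
  coeff (P ⊕ Q) i        ≡⟨ coeff-⊕ P Q i ⟩
  coeff P i + coeff Q i  ≡⟨ +-comm (coeff P i) _ ⟩
  coeff Q i + coeff P i  ≡⟨ coeff-⊕ Q P i ⟨
  coeff (Q ⊕ P) i        ∎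
  where open ≡-Reasoning

⊕-assoc : ∀ P Q R → (P ⊕ Q) ⊕ R ≋ P ⊕ (Q ⊕ R)
⊕-assoc P Q R = mk≋ λ i → begin
  coeff ((P ⊕ Q) ⊕ R) i                ≡⟨ coeff-⊕ (P ⊕ Q) R i ⟩
  coeff (P ⊕ Q) i + coeff R i          ≡⟨ cong (_+ coeff R i) (coeff-⊕ P Q i) ⟩
  coeff P i + coeff Q i + coeff R i    ≡⟨ +-assoc (coeff P i) _ _ ⟩
  coeff P i + (coeff Q i + coeff R i)  ≡⟨ cong (coeff P i +_) (coeff-⊕ Q R i) ⟨
  coeff P i + coeff (Q ⊕ R) i          ≡⟨ coeff-⊕ P (Q ⊕ R) i ⟨
  coeff (P ⊕ (Q ⊕ R)) i                ∎
  where open ≡-Reasoning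

⊕-identityʳ : ∀ P → P ⊕ [] ≋ P
⊕-identityʳ P = mk≋ λ i → trans (coeff-⊕ P [] i) (+-identityʳ _)

⊕-interchange : ∀ P Q R S → (P ⊕ Q) ⊕ (R ⊕ S) ≋ (P ⊕ R) ⊕ (Q ⊕ S)
⊕-interchange P Q R S = begin
  (P ⊕ Q) ⊕ (R ⊕ S)  ≈⟨ ⊕-assoc P Q (R ⊕ S) ⟩
  P ⊕ (Q ⊕ (R ⊕ S))  ≈⟨ ⊕-congʳ P (⊕-assoc Q R S) ⟨
  P ⊕ ((Q ⊕ R) ⊕ S)  ≈⟨ ⊕-congʳ P (⊕-cong (⊕-comm Q R) (≋-refl {S})) ⟩
  P ⊕ ((R ⊕ Q) ⊕ S)  ≈⟨ ⊕-congʳ P (⊕-assoc R Q S) ⟩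
  P ⊕ (R ⊕ (Q ⊕ S))  ≈⟨ ⊕-assoc P R (Q ⊕ S) ⟨
  (P ⊕ R) ⊕ (Q ⊕ S)  ∎
  where open ≋-Reasoning

scale-congʳ : ∀ c {P Q} → P ≋ Q → scale c P ≋ scale c Q
scale-congʳ c {P} {Q} e = mk≋ λ i →
  trans (coeff-scale c P i) (trans (cong (c *_) (at e i)) (sym (coeff-scale c Q i)))

scale-congˡ : ∀ {a b} P → a ≡ b → scale a P ≋ scale b P
scale-congˡ P refl = ≋-refl

scale-zero : ∀ P → scale 0 P ≋ []
scale-zero P = mk≋ (coeff-scale 0 P)

scale-one : ∀ P → scale 1 P ≋ P
scale-one P = mk≋ λ i → trans (coeff-scale 1 P i) (*-identityˡ _)

scale-distribʳ : ∀ a b P → scale (a + b) P ≋ scale a P ⊕ scale b P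
scale-distribʳ a b P = mk≋ λ i → begin
  coeff (scale (a + b) P) i                   ≡⟨ coeff-scale (a + b) P i ⟩
  (a + b) * coeff P i                         ≡⟨ *-distribʳ-+ (coeff P i) a b ⟩
  a * coeff P i + b * coeff P i               ≡⟨ cong₂ _+_ (coeff-scale a P i) (coeff-scale b P i) ⟨
  coeff (scale a P) i + coeff (scale b P) i   ≡⟨ coeff-⊕ (scale a P) (scale b P) i ⟨
  coeff (scale a P ⊕ scale b P) i             ∎
  where open ≡-Reasoning

scale-suc : ∀ c P → scale (suc c) P ≋ P ⊕ scale c P
scale-suc c P = ≋-trans (scale-distribʳ 1 c P) (⊕-cong (scale-one P) ≋-refl)

scale-distribˡ : ∀ c P Q → scale c (P ⊕ Q) ≋ scale c P ⊕ scale c Q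
scale-distribˡ c P Q = mk≋ λ i → begin
  coeff (scale c (P ⊕ Q)) i                   ≡⟨ coeff-scale c (P ⊕ Q) i ⟩
  c * coeff (P ⊕ Q) i                         ≡⟨ cong (c *_) (coeff-⊕ P Q i) ⟩
  c * (coeff P i + coeff Q i)                 ≡⟨ *-distribˡ-+ c _ _ ⟩
  c * coeff P i + c * coeff Q i               ≡⟨ cong₂ _+_ (coeff-scale c P i) (coeff-scale c Q i) ⟨
  coeff (scale c P) i + coeff (scale c Q) i   ≡⟨ coeff-⊕ (scale c P) (scale c Q) i ⟨
  coeff (scale c P ⊕ scale c Q) i             ∎
  where open ≡-Reasoning

coeff-⊗-∷ : ∀ a P R i → coeff ((a ∷ P) ⊗ R) i ≡ a * coeff R i + coeff (0 ∷ P ⊗ R) i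
coeff-⊗-∷ a P R i =
  trans (coeff-⊕ (scale a R) (0 ∷ P ⊗ R) i) (cong (_+ coeff (0 ∷ P ⊗ R) i) (coeff-scale a R i))

⊗-zeroˡ : ∀ {P} R → P ≋ [] → P ⊗ R ≋ []
⊗-zeroˡ {[]}    R z = ≋-refl
⊗-zeroˡ {a ∷ P} R z = mk≋ λ i → begin
  coeff ((a ∷ P) ⊗ R) i                 ≡⟨ coeff-⊗-∷ a P R i ⟩
  a * coeff R i + coeff (0 ∷ P ⊗ R) i   ≡⟨ cong₂ _+_ (cong (_* coeff R i) (at z 0))
                                                     (at (∷-cong refl (⊗-zeroˡ {P} R (mk≋ λ j → at z (suc j)))) i) ⟩
  coeff (0 ∷ []) i                      ≡⟨ coeff-0∷[] i ⟩
  0                                     ∎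
  where
  open ≡-Reasoning
  coeff-0∷[] : ∀ i → coeff (0 ∷ []) i ≡ 0
  coeff-0∷[] zero    = refl
  coeff-0∷[] (suc i) = refl

⊗-congˡ : ∀ {P P′} R → P ≋ P′ → P ⊗ R ≋ P′ ⊗ R
⊗-congˡ {[]}    {P′}     R e = ≋-sym (⊗-zeroˡ R (≋-sym e))
⊗-congˡ {a ∷ P} {[]}     R e = ⊗-zeroˡ R e
⊗-congˡ {a ∷ P} {b ∷ P′} R e = mk≋ λ i → begin
  coeff ((a ∷ P) ⊗ R) i
    ≡⟨ coeff-⊗-∷ a P R i ⟩
  a * coeff R i + coeff (0 ∷ P ⊗ R) i
    ≡⟨ cong₂ _+_ (cong (_* coeff R i) (at e 0))
                                                      (at (∷-cong refl (⊗-congˡ {P} {P′} R (mk≋ λ j → at e (suc j)))) i) ⟩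
  b * coeff R i + coeff (0 ∷ P′ ⊗ R) i
    ≡⟨ coeff-⊗-∷ b P′ R i ⟨
  coeff ((b ∷ P′) ⊗ R) i ∎
  where open ≡-Reasoning

⊗-identityˡ : ∀ R → one ⊗ R ≋ R
⊗-identityˡ R = ≋-trans (⊕-cong (scale-one R) (mk≋ λ { zero → refl ; (suc i) → refl })) (⊕-identityʳ R)

X⊗≋∷ : ∀ R → X ⊗ R ≋ 0 ∷ R
X⊗≋∷ R = mk≋ λ i → trans (coeff-⊗-∷ 0 (1 ∷ []) R i) (at (∷-cong refl (⊗-identityˡ R)) i)

X⊗-cong : ∀ {P Q} → P ≋ Q → X ⊗ P ≋ X ⊗ Q
X⊗-cong {P} {Q} e = ≋-trans (X⊗≋∷ P) (≋-trans (∷-cong refl e) (≋-sym (X⊗≋∷ Q)))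

X⊗-zero : X ⊗ [] ≋ []
X⊗-zero = ≋-trans (X⊗≋∷ []) (mk≋ λ { zero → refl ; (suc i) → refl })

X⊗-distrib-⊕ : ∀ P Q → X ⊗ (P ⊕ Q) ≋ X ⊗ P ⊕ X ⊗ Q
X⊗-distrib-⊕ P Q = ≋-trans (X⊗≋∷ (P ⊕ Q)) (≋-sym (⊕-cong (X⊗≋∷ P) (X⊗≋∷ Q)))

X⊗-scale : ∀ c P → X ⊗ scale c P ≋ scale c (X ⊗ P)
X⊗-scale c P = ≋-trans (X⊗≋∷ (scale c P)) (≋-trans (mk≋ λ { zero → sym (*-zeroʳ c) ; (suc i) → refl })
                                                     (scale-congʳ c (≋-sym (X⊗≋∷ P))))

X⊗-assoc : ∀ P R → (X ⊗ P) ⊗ R ≋ X ⊗ (P ⊗ R)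
X⊗-assoc P R = ≋-trans (⊗-congˡ R (X⊗≋∷ P))
                       (≋-trans (mk≋ (coeff-⊗-∷ 0 P R)) (≋-sym (X⊗≋∷ (P ⊗ R))))

1+X⊗ : ∀ Q → (1 ∷ 1 ∷ []) ⊗ Q ≋ Q ⊕ (0 ∷ Q)
1+X⊗ Q = ⊕-cong (scale-one Q) (∷-cong refl (⊗-identityˡ Q))

shift : ℕ → Poly → Poly
shift a P = replicate a 0 ++ P

shift-cong : ∀ a {P Q} → P ≋ Q → shift a P ≋ shift a Q
shift-cong zero    e = e
shift-cong (suc a) e = ∷-cong refl (shift-cong a e)

shift-⊕ : ∀ a P Q → shift a (P ⊕ Q) ≋ shift a P ⊕ shift a Q
shift-⊕ zero    P Q = ≋-refl
shift-⊕ (suc a) P Q = ∷-cong refl (shift-⊕ a P Q)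

shift-∷0 : ∀ a Q → shift a (0 ∷ Q) ≋ 0 ∷ shift a Q
shift-∷0 zero    Q = ≋-refl
shift-∷0 (suc a) Q = ∷-cong refl (shift-∷0 a Q)

xpow⊗≋shift : ∀ a R → xpow a ⊗ R ≋ shift a R
xpow⊗≋shift zero    R = ⊗-identityˡ R
xpow⊗≋shift (suc a) R = begin
  (X ⊗ xpow a) ⊗ R   ≈⟨ X⊗-assoc (xpow a) R ⟩
  X ⊗ (xpow a ⊗ R)   ≈⟨ X⊗≋∷ (xpow a ⊗ R) ⟩
  0 ∷ xpow a ⊗ R     ≈⟨ ∷-cong refl (xpow⊗≋shift a R) ⟩
  0 ∷ shift a R      ∎
  where open ≋-Reasoning

xpow≋shift : ∀ a → xpow a ≋ shift a one
xpow≋shift zero    = ≋-refl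
xpow≋shift (suc a) = ≋-trans (X⊗≋∷ (xpow a)) (∷-cong refl (xpow≋shift a))

⊗xpow≋shift : ∀ P a → P ⊗ xpow a ≋ shift a P
⊗xpow≋shift []      a = mk≋ λ i → sym (coeff-zeros a i)
  where
  coeff-zeros : ∀ a i → coeff (shift a []) i ≡ 0
  coeff-zeros zero    i       = refl
  coeff-zeros (suc a) zero    = refl
  coeff-zeros (suc a) (suc i) = coeff-zeros a i
⊗xpow≋shift (c ∷ P) a = begin
  scale c (xpow a) ⊕ (0 ∷ P ⊗ xpow a)
    ≈⟨ ⊕-cong (scale-congʳ c (xpow≋shift a)) (∷-cong refl (⊗xpow≋shift P a)) ⟩
  scale c (shift a one) ⊕ (0 ∷ shift a P)
    ≈⟨ split a ⟨
  shift a (c ∷ P) ∎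
  where
  open ≋-Reasoning
  split : ∀ a → shift a (c ∷ P) ≋ scale c (shift a one) ⊕ (0 ∷ shift a P)
  split zero    = ∷-cong (sym (trans (+-identityʳ (c * 1)) (*-identityʳ c))) ≋-refl
  split (suc a) = ∷-cong (sym (trans (+-identityʳ (c * 0)) (*-zeroʳ c))) (split a)

record DegreeBelow (P : Poly) (d : ℕ) : Set where
  constructor mkDeg
  field vanish : ∀ j → d ≤ j → coeff P j ≡ 0
open DegreeBelow public

DegreeBelow-mono : ∀ {P d e} → d ≤ e → DegreeBelow P d → DegreeBelow P e
DegreeBelow-mono d≤e D = mkDeg λ j e≤j → vanish D j (≤-trans d≤e e≤j)

DegreeBelow-⊕ : ∀ {P Q d} → DegreeBelow P d → DegreeBelow Q d → DegreeBelow (P ⊕ Q) d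
DegreeBelow-⊕ {P} {Q} DP DQ = mkDeg λ j d≤j →
  trans (coeff-⊕ P Q j) (cong₂ _+_ (vanish DP j d≤j) (vanish DQ j d≤j))

DegreeBelow-scale : ∀ c {P d} → DegreeBelow P d → DegreeBelow (scale c P) d
DegreeBelow-scale c {P} D = mkDeg λ j d≤j →
  trans (coeff-scale c P j) (trans (cong (c *_) (vanish D j d≤j)) (*-zeroʳ c))

DegreeBelow-resp-≋ : ∀ {P Q d} → P ≋ Q → DegreeBelow Q d → DegreeBelow P d
DegreeBelow-resp-≋ e D = mkDeg λ j d≤j → trans (at e j) (vanish D j d≤j)

DegreeBelow-∷ : ∀ {c P d} → DegreeBelow P d → DegreeBelow (c ∷ P) (suc d)
DegreeBelow-∷ D = mkDeg λ { (suc j) (s≤s d≤j) → vanish D j d≤j }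

DegreeBelow-shift : ∀ a {P d} → DegreeBelow P d → DegreeBelow (shift a P) (a + d)
DegreeBelow-shift zero    D = D
DegreeBelow-shift (suc a) D = DegreeBelow-∷ (DegreeBelow-shift a D)

-- Binomial sums and the recurrence of part (a)

sumTo-cong : ∀ k {f g} → (∀ i → i ≤ k → f i ≋ g i) → sumTo k f ≋ sumTo k g
sumTo-cong zero    e = e 0 z≤n
sumTo-cong (suc k) e = ⊕-cong (sumTo-cong k (λ i i≤k → e i (m≤n⇒m≤1+n i≤k))) (e (suc k) ≤-refl)

sumTo-⊕ : ∀ k f g → sumTo k (λ i → f i ⊕ g i) ≋ sumTo k f ⊕ sumTo k g
sumTo-⊕ zero    f g = ≋-refl
sumTo-⊕ (suc k) f g = ≋-trans (⊕-cong (sumTo-⊕ k f g) ≋-refl)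
                              (⊕-interchange (sumTo k f) (sumTo k g) (f (suc k)) (g (suc k)))

X⊗-sumTo : ∀ k f → X ⊗ sumTo k f ≋ sumTo k (λ i → X ⊗ f i)
X⊗-sumTo zero    f = ≋-refl
X⊗-sumTo (suc k) f = ≋-trans (X⊗-distrib-⊕ (sumTo k f) (f (suc k))) (⊕-cong (X⊗-sumTo k f) ≋-refl)

sumTo-unfoldˡ : ∀ k f → sumTo (suc k) f ≋ f 0 ⊕ sumTo k (λ i → f (suc i))
sumTo-unfoldˡ zero    f = ≋-refl
sumTo-unfoldˡ (suc k) f = ≋-trans (⊕-cong (sumTo-unfoldˡ k f) ≋-refl)
                                  (⊕-assoc (f 0) (sumTo k (λ i → f (suc i))) (f (suc (suc k))))

-- The term i = k + 1 of the shifted sum vanishes, since C(k, k + 1) = 0.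
binomial-sum-unfoldˡ : ∀ k (G : ℕ → Poly) →
  G 0 ⊕ sumTo k (λ i → scale (k C suc i) (G (suc i))) ≋ sumTo k (λ i → scale (k C i) (G i))
binomial-sum-unfoldˡ zero    G =
  ≋-trans (⊕-congʳ (G 0) (scale-zero (G 1))) (≋-trans (⊕-identityʳ (G 0)) (≋-sym (scale-one (G 0))))
binomial-sum-unfoldˡ (suc k) G = begin
  G 0 ⊕ (S ⊕ scale (suc k C suc (suc k)) (G (suc (suc k))))
    ≈⟨ ⊕-congʳ (G 0) (⊕-congʳ S (scale-congˡ _ (k>n⇒nCk≡0 (n<1+n (suc k))))) ⟩
  G 0 ⊕ (S ⊕ scale 0 (G (suc (suc k))))
    ≈⟨ ⊕-congʳ (G 0) (≋-trans (⊕-congʳ S (scale-zero _)) (⊕-identityʳ S)) ⟩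
  G 0 ⊕ S
    ≈⟨ ⊕-cong (scale-one (G 0)) (≋-refl {S}) ⟨
  scale 1 (G 0) ⊕ S
    ≈⟨ sumTo-unfoldˡ k (λ i → scale (suc k C i) (G i)) ⟨
  sumTo (suc k) (λ i → scale (suc k C i) (G i)) ∎
  where
  open ≋-Reasoning
  S = sumTo k (λ i → scale (suc k C suc i) (G (suc i)))

binomial-sum-pascal : ∀ k (G : ℕ → Poly) →
  sumTo (suc k) (λ i → scale (suc k C i) (G i))
    ≋ sumTo k (λ i → scale (k C i) (G i)) ⊕ sumTo k (λ i → scale (k C i) (G (suc i)))
binomial-sum-pascal k G = begin
  sumTo (suc k) (λ i → scale (suc k C i) (G i))       ≈⟨ sumTo-unfoldˡ k (λ i → scale (suc k C i) (G i)) ⟩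
  scale 1 (G 0) ⊕ sumTo k (λ i → scale (suc k C suc i) (G (suc i)))
    ≈⟨ ⊕-cong (scale-one (G 0)) (sumTo-cong k (λ i _ → pascal i)) ⟩
  G 0 ⊕ sumTo k (λ i → below i ⊕ same i)              ≈⟨ ⊕-congʳ (G 0) (sumTo-⊕ k below same) ⟩
  G 0 ⊕ (sumTo k below ⊕ sumTo k same)                 ≈⟨ ⊕-congʳ (G 0) (⊕-comm (sumTo k below) _) ⟩
  G 0 ⊕ (sumTo k same ⊕ sumTo k below)                 ≈⟨ ⊕-assoc (G 0) (sumTo k same) _ ⟨
  (G 0 ⊕ sumTo k same) ⊕ sumTo k below                 ≈⟨ ⊕-cong (binomial-sum-unfoldˡ k G) ≋-refl ⟩
  sumTo k (λ i → scale (k C i) (G i)) ⊕ sumTo k below  ∎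
  where
  open ≋-Reasoning
  below same : ℕ → Poly
  below i = scale (k C i) (G (suc i))
  same  i = scale (k C suc i) (G (suc i))
  pascal : ∀ i → scale (suc k C suc i) (G (suc i)) ≋ below i ⊕ same i
  pascal i = ≋-trans (scale-congˡ (G (suc i)) (sym (nCk+nC[k+1]≡[n+1]C[k+1] k i)))
                     (scale-distribʳ (k C i) (k C suc i) (G (suc i)))

record SolvesRecurrence (T : ℕ → ℕ → Poly) : Set where
  field
    initial : ∀ n → T n 0 ≋ A n
    step    : ∀ n k → k < n → T n (suc k) ≋ T n k ⊕ X ⊗ T (n ∸ 1) k

recurrence-unique : ∀ {T T′} → SolvesRecurrence T → SolvesRecurrence T′ →
                    ∀ n k → k ≤ n → T n k ≋ T′ n k
recurrence-unique S S′ n       zero    _         =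
  ≋-trans (SolvesRecurrence.initial S n) (≋-sym (SolvesRecurrence.initial S′ n))
recurrence-unique S S′ (suc n) (suc k) (s≤s k≤n) =
  ≋-trans (SolvesRecurrence.step S (suc n) k (s≤s k≤n))
  (≋-trans (⊕-cong (recurrence-unique S S′ (suc n) k (m≤n⇒m≤1+n k≤n))
                   (X⊗-cong (recurrence-unique S S′ n k k≤n)))
           (≋-sym (SolvesRecurrence.step S′ (suc n) k (s≤s k≤n))))

map-cong-∈ : ∀ {A B : Set} {f g : A → B} {L} → (∀ {x} → x ∈ L → f x ≡ g x) → map f L ≡ map g L
map-cong-∈ {L = []}    e = refl
map-cong-∈ {L = x ∷ L} e = cong₂ _∷_ (e (here refl)) (map-cong-∈ (e ∘ there))

sumOver : {A : Set} → List A → (A → Poly) → Poly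
sumOver L F = psum (map F L)

module _ {A : Set} where

  coeff-sumOver : ∀ (L : List A) F i → coeff (sumOver L F) i ≡ sum (map (λ x → coeff (F x) i) L)
  coeff-sumOver []      F i = refl
  coeff-sumOver (x ∷ L) F i = trans (coeff-⊕ (F x) (sumOver L F) i) (cong (coeff (F x) i +_) (coeff-sumOver L F i))

  sumOver-↭ : ∀ {L L′ : List A} F → L ↭ L′ → sumOver L F ≋ sumOver L′ F
  sumOver-↭ {L} {L′} F L↭L′ = mk≋ λ i →
    trans (coeff-sumOver L F i) (trans (sum-↭ (↭-map⁺ _ L↭L′)) (sym (coeff-sumOver L′ F i)))

  sumOver-map : ∀ {B : Set} (φ : A → B) L (F : B → Poly) → sumOver (map φ L) F ≡ sumOver L (F ∘ φ)
  sumOver-map φ []      F = refl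
  sumOver-map φ (x ∷ L) F = cong (F (φ x) ⊕_) (sumOver-map φ L F)

  sumOver-≡ : ∀ L {F G : A → Poly} → (∀ x → F x ≡ G x) → sumOver L F ≡ sumOver L G
  sumOver-≡ []      e = refl
  sumOver-≡ (x ∷ L) e = cong₂ _⊕_ (e x) (sumOver-≡ L e)

  sumOver-cong : ∀ L {F G : A → Poly} → (∀ x → x ∈ L → F x ≋ G x) → sumOver L F ≋ sumOver L G
  sumOver-cong []      e = ≋-refl
  sumOver-cong (x ∷ L) e = ⊕-cong (e x (here refl)) (sumOver-cong L (λ y y∈L → e y (there y∈L)))

  sumOver-⊕ : ∀ L (F G : A → Poly) → sumOver L (λ x → F x ⊕ G x) ≋ sumOver L F ⊕ sumOver L G
  sumOver-⊕ []      F G = ≋-refl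
  sumOver-⊕ (x ∷ L) F G = ≋-trans (⊕-congʳ (F x ⊕ G x) (sumOver-⊕ L F G))
                                  (⊕-interchange (F x) (G x) (sumOver L F) (sumOver L G))

  X⊗-sumOver : ∀ L (F : A → Poly) → X ⊗ sumOver L F ≋ sumOver L (λ x → X ⊗ F x)
  X⊗-sumOver []      F = X⊗-zero
  X⊗-sumOver (x ∷ L) F = ≋-trans (X⊗-distrib-⊕ (F x) (sumOver L F)) (⊕-congʳ (X ⊗ F x) (X⊗-sumOver L F))

  sumOver-filter : ∀ {P : Pred A 0ℓ} (P? : Decidable P) L F →
                   sumOver (filter P? L) F ≋ sumOver L (λ x → if does (P? x) then F x else [])
  sumOver-filter P? []      F = ≋-refl
  sumOver-filter P? (x ∷ L) F with does (P? x)
  ... | true  = ⊕-congʳ (F x) (sumOver-filter P? L F)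
  ... | false = sumOver-filter P? L F

  sumOver-sumTo : ∀ L m (F : A → ℕ → Poly) →
                  sumOver L (λ x → sumTo m (F x)) ≋ sumTo m (λ j → sumOver L (λ x → F x j))
  sumOver-sumTo L zero    F = ≋-refl
  sumOver-sumTo L (suc m) F = ≋-trans (sumOver-⊕ L (λ x → sumTo m (F x)) (λ x → F x (suc m)))
                                      (⊕-cong (sumOver-sumTo L m F) ≋-refl)

  DegreeBelow-sumOver : ∀ L {F : A → Poly} {d} → (∀ x → x ∈ L → DegreeBelow (F x) d) →
                        DegreeBelow (sumOver L F) d
  DegreeBelow-sumOver []      D = mkDeg λ _ _ → refl
  DegreeBelow-sumOver (x ∷ L) D =
    DegreeBelow-⊕ (D x (here refl)) (DegreeBelow-sumOver L (λ y y∈L → D y (there y∈L)))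

  coeff-sumOver-cong : ∀ L (F G : A → Poly) i j → (∀ x → x ∈ L → coeff (F x) i ≡ coeff (G x) j) →
                       coeff (sumOver L F) i ≡ coeff (sumOver L G) j
  coeff-sumOver-cong L F G i j e = begin
    coeff (sumOver L F) i                   ≡⟨ coeff-sumOver L F i ⟩
    sum (map (λ x → coeff (F x) i) L)       ≡⟨ cong sum (map-cong-∈ (e _)) ⟩
    sum (map (λ x → coeff (G x) j) L)       ≡⟨ coeff-sumOver L G j ⟨
    coeff (sumOver L G) j                   ∎
    where open ≡-Reasoning

  Unique-map⁺ : ∀ {B : Set} (f : A → B) {P : A → Set} {L} →
                (∀ {x y} → P x → P y → f x ≡ f y → x ≡ y) → All P L → Unique L → Unique (map f L)
  Unique-map⁺ f inj []         []       = []
  Unique-map⁺ f inj (px ∷ pxs) (x∉ ∷ u) = distinct px pxs x∉ ∷ Unique-map⁺ f inj pxs u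
    where
    distinct : ∀ {x L} → _ → All _ L → All (x ≢_) L → All (f x ≢_) (map f L)
    distinct px []         []         = []
    distinct px (py ∷ pys) (x≢y ∷ ns) = (λ e → x≢y (inj px py e)) ∷ distinct px pys ns

sumOver-bijection : ∀ {A B : Set} {La : List A} {Lb : List B} (φ : A → B) (ψ : B → A) →
  Unique La → Unique Lb →
  (∀ {a} → a ∈ La → φ a ∈ Lb) → (∀ {b} → b ∈ Lb → ψ b ∈ La) →
  (∀ {a} → a ∈ La → ψ (φ a) ≡ a) → (∀ {b} → b ∈ Lb → φ (ψ b) ≡ b) →
  (F : B → Poly) → sumOver La (F ∘ φ) ≋ sumOver Lb F
sumOver-bijection {La = La} {Lb} φ ψ uLa uLb φ∈ ψ∈ ψφ φψ F =
  subst (_≋ sumOver Lb F) (sumOver-map φ La F) (sumOver-↭ F image↭Lb)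
  where
  injective : ∀ {x y} → x ∈ La → y ∈ La → φ x ≡ φ y → x ≡ y
  injective x∈ y∈ e = trans (sym (ψφ x∈)) (trans (cong ψ e) (ψφ y∈))
  image⊆ : ∀ {b} → b ∈ map φ La → b ∈ Lb
  image⊆ b∈ with ∈-map⁻ φ b∈
  ... | a , a∈ , refl = φ∈ a∈
  image⊇ : ∀ {b} → b ∈ Lb → b ∈ map φ La
  image⊇ b∈ = subst (_∈ map φ La) (φψ b∈) (∈-map⁺ φ (ψ∈ b∈))
  image↭Lb : map φ La ↭ Lb
  image↭Lb =
    ∼bag⇒↭ (unique∧set⇒bag (Unique-map⁺ φ injective (All.tabulate id) uLa) uLb (mk⇔ image⊆ image⊇))

data Compare<ᵇ (a b : ℕ) : Set where
  lt : a < b → (a <ᵇ b) ≡ true  → Compare<ᵇ a b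
  ge : b ≤ a → (a <ᵇ b) ≡ false → Compare<ᵇ a b

compare<ᵇ : ∀ a b → Compare<ᵇ a b
compare<ᵇ zero    zero    = ge z≤n refl
compare<ᵇ zero    (suc b) = lt (s≤s z≤n) refl
compare<ᵇ (suc a) zero    = ge z≤n refl
compare<ᵇ (suc a) (suc b) with compare<ᵇ a b
... | lt a<b e = lt (s≤s a<b) e
... | ge b≤a e = ge (s≤s b≤a) e

<ᵇ-true : ∀ {a b} → a < b → (a <ᵇ b) ≡ true
<ᵇ-true {a} {b} a<b with compare<ᵇ a b
... | lt _   e = e
... | ge b≤a _ = ⊥-elim (<⇒≱ a<b b≤a)

<ᵇ-false : ∀ {a b} → b ≤ a → (a <ᵇ b) ≡ false
<ᵇ-false {a} {b} b≤a with compare<ᵇ a b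
... | lt a<b _ = ⊥-elim (<⇒≱ a<b b≤a)
... | ge _   e = e

≟-true : ∀ {a b} → a ≡ b → does (a ≟ℕ b) ≡ true
≟-true {a} {b} = dec-true (a ≟ℕ b)

≟-false : ∀ {a b} → a ≢ b → does (a ≟ℕ b) ≡ false
≟-false {a} {b} = dec-false (a ≟ℕ b)

𝟙 : Bool → ℕ
𝟙 b = if b then 1 else 0

𝟙≤1 : ∀ b → 𝟙 b ≤ 1
𝟙≤1 true  = ≤-refl
𝟙≤1 false = z≤n

desᴸ : List ℕ → ℕ
desᴸ []          = 0
desᴸ (a ∷ [])    = 0
desᴸ (a ∷ b ∷ l) = 𝟙 (b <ᵇ a) + desᴸ (b ∷ l)

-- Σⱼ G (i + j) (l j): the entries of l are read as the values at positions i, i + 1, …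
positional : (ℕ → ℕ → ℕ) → ℕ → List ℕ → ℕ
positional G i []      = 0
positional G i (a ∷ l) = G i a + positional G (suc i) l

excᴸ : ℕ → List ℕ → ℕ
excᴸ = positional (λ i a → 𝟙 (i <ᵇ a))

fixᴸ : ℕ → ℕ → List ℕ → ℕ
fixᴸ k = positional (λ i a → 𝟙 (does (a ≟ℕ i) ∧ (i <ᵇ k)))

desᴸ-bound : ∀ a l → desᴸ (a ∷ l) ≤ length l
desᴸ-bound a []      = z≤n
desᴸ-bound a (b ∷ l) with b <ᵇ a
... | true  = s≤s (desᴸ-bound b l)
... | false = m≤n⇒m≤1+n (desᴸ-bound b l)

excᴸ-bound : ∀ i l → excᴸ i l ≤ length l
excᴸ-bound i []      = z≤n
excᴸ-bound i (a ∷ l) with i <ᵇ a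
... | true  = s≤s (excᴸ-bound (suc i) l)
... | false = m≤n⇒m≤1+n (excᴸ-bound (suc i) l)

desᴸ-map : ∀ (f : ℕ → ℕ) → (∀ a b → (f b <ᵇ f a) ≡ (b <ᵇ a)) → ∀ l → desᴸ (map f l) ≡ desᴸ l
desᴸ-map f mono []          = refl
desᴸ-map f mono (a ∷ [])    = refl
desᴸ-map f mono (a ∷ b ∷ l) = cong₂ _+_ (cong 𝟙 (mono a b)) (desᴸ-map f mono (b ∷ l))

punchIn : ℕ → ℕ → ℕ
punchIn h a = if a <ᵇ h then a else suc a

punchOut : ℕ → ℕ → ℕ
punchOut h a = if a <ᵇ h then a else pred a

punchIn-< : ∀ {h a} → a < h → punchIn h a ≡ a
punchIn-< a<h rewrite <ᵇ-true a<h = refl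

map-punchIn-id : ∀ {h} l → All (_< h) l → map (punchIn h) l ≡ l
map-punchIn-id l bounded = trans (map-cong-∈ (λ a∈ → punchIn-< (All.lookup bounded a∈))) (List.map-id l)

punchIn-<ᵇ : ∀ h a b → (punchIn h b <ᵇ punchIn h a) ≡ (b <ᵇ a)
punchIn-<ᵇ h a b with compare<ᵇ b h | compare<ᵇ a h
... | lt b<h e₁ | lt a<h e₂ rewrite e₁ | e₂ = refl
... | lt b<h e₁ | ge h≤a e₂ rewrite e₁ | e₂ =
  trans (<ᵇ-true (≤-trans b<h (m≤n⇒m≤1+n h≤a))) (sym (<ᵇ-true (≤-trans b<h h≤a)))
... | ge h≤b e₁ | lt a<h e₂ rewrite e₁ | e₂ =
  trans (<ᵇ-false (≤-trans (<⇒≤ a<h) (m≤n⇒m≤1+n h≤b))) (sym (<ᵇ-false (≤-trans (<⇒≤ a<h) h≤b)))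
... | ge h≤b e₁ | ge h≤a e₂ rewrite e₁ | e₂ = refl

punchIn-≢ : ∀ h a → punchIn h a ≢ h
punchIn-≢ h a e with compare<ᵇ a h
... | lt a<h e₁ rewrite e₁ = <-irrefl e a<h
... | ge h≤a e₁ rewrite e₁ = <-irrefl (sym e) (s≤s h≤a)

punchIn-injective : ∀ h {a b} → punchIn h a ≡ punchIn h b → a ≡ b
punchIn-injective h {a} {b} e with compare<ᵇ a h | compare<ᵇ b h
... | lt _   e₁ | lt _   e₂ rewrite e₁ | e₂ = e
... | lt a<h e₁ | ge h≤b e₂ rewrite e₁ | e₂ =
  ⊥-elim (<-irrefl refl (subst (_≤ b) e (≤-trans (<⇒≤ a<h) h≤b)))
... | ge h≤a e₁ | lt b<h e₂ rewrite e₁ | e₂ =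
  ⊥-elim (<-irrefl refl (subst (_≤ a) (sym e) (≤-trans (<⇒≤ b<h) h≤a)))
... | ge _   e₁ | ge _   e₂ rewrite e₁ | e₂ = cong pred e

punchIn-bound : ∀ {h a m} → a < m → punchIn h a < suc m
punchIn-bound {h} {a} a<m with compare<ᵇ a h
... | lt _ e rewrite e = m≤n⇒m≤1+n a<m
... | ge _ e rewrite e = s≤s a<m

punchOut-punchIn : ∀ h a → punchOut h (punchIn h a) ≡ a
punchOut-punchIn h a with compare<ᵇ a h
... | lt _   e rewrite e | e = refl
... | ge h≤a e rewrite e | <ᵇ-false (m≤n⇒m≤1+n h≤a) = refl

punchIn-punchOut : ∀ h a → a ≢ h → punchIn h (punchOut h a) ≡ a
punchIn-punchOut h a a≢h with compare<ᵇ a h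
... | lt _ e rewrite e | e = refl
punchIn-punchOut h zero    a≢h | ge z≤n e = ⊥-elim (a≢h refl)
punchIn-punchOut h (suc a) a≢h | ge h≤a e rewrite e with compare<ᵇ a h
... | ge _   e₂ rewrite e₂ = refl
... | lt a<h _  = ⊥-elim (a≢h (≤-antisym a<h h≤a))

punchOut-bound : ∀ {h a m} → h ≤ m → a ≢ h → a < suc m → punchOut h a < m
punchOut-bound {h} {a} h≤m a≢h a<1+m with compare<ᵇ a h
punchOut-bound {h} {a}     h≤m a≢h a<1+m     | lt a<h e rewrite e = ≤-trans a<h h≤m
punchOut-bound {h} {zero}  h≤m a≢h a<1+m     | ge z≤n e = ⊥-elim (a≢h refl)
punchOut-bound {h} {suc a} h≤m a≢h (s≤s a<m) | ge _   e rewrite e = a<m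

map-punchOut-punchIn : ∀ h l → map (punchOut h) (map (punchIn h) l) ≡ l
map-punchOut-punchIn h l = trans (sym (List.map-∘ l)) (trans (List.map-cong (punchOut-punchIn h) l) (List.map-id l))

map-punchIn-punchOut : ∀ h l → All (_≢ h) l → map (punchIn h) (map (punchOut h) l) ≡ l
map-punchIn-punchOut h l l≢h =
  trans (sym (List.map-∘ l)) (trans (map-cong-∈ (λ a∈ → punchIn-punchOut h _ (All.lookup l≢h a∈))) (List.map-id l))

punchOut-injective : ∀ h {a b} → a ≢ h → b ≢ h → punchOut h a ≡ punchOut h b → a ≡ b
punchOut-injective h {a} {b} a≢h b≢h e =
  trans (sym (punchIn-punchOut h a a≢h)) (trans (cong (punchIn h) e) (punchIn-punchOut h b b≢h))

nthOr : ℕ → List ℕ → ℕ → ℕ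
nthOr d []      _       = d
nthOr d (a ∷ l) zero    = a
nthOr d (a ∷ l) (suc p) = nthOr d l p

nth : List ℕ → ℕ → ℕ
nth = nthOr 0

insertAt : ℕ → ℕ → List ℕ → List ℕ
insertAt zero    x l       = x ∷ l
insertAt (suc p) x []      = x ∷ []
insertAt (suc p) x (a ∷ l) = a ∷ insertAt p x l

removeAt : ℕ → List ℕ → List ℕ
removeAt _       []      = []
removeAt zero    (a ∷ l) = l
removeAt (suc p) (a ∷ l) = a ∷ removeAt p l

setAt : ℕ → ℕ → List ℕ → List ℕ
setAt _       x []      = []
setAt zero    x (a ∷ l) = x ∷ l
setAt (suc p) x (a ∷ l) = a ∷ setAt p x l

init : List ℕ → List ℕ
init []          = []
init (a ∷ [])    = []
init (a ∷ b ∷ l) = a ∷ init (b ∷ l)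

lastOr : ℕ → List ℕ → ℕ
lastOr d []          = d
lastOr d (a ∷ [])    = a
lastOr d (a ∷ b ∷ l) = lastOr d (b ∷ l)

nth-insertAt : ∀ p x l → p ≤ length l → nth (insertAt p x l) p ≡ x
nth-insertAt zero    x l       _         = refl
nth-insertAt (suc p) x (a ∷ l) (s≤s p≤) = nth-insertAt p x l p≤

insertAt-↭ : ∀ p x l → insertAt p x l ↭ x ∷ l
insertAt-↭ zero    x l       = ↭-refl
insertAt-↭ (suc p) x []      = ↭-refl
insertAt-↭ (suc p) x (a ∷ l) = ↭-trans (↭-prep a (insertAt-↭ p x l)) (↭-swap a x ↭-refl)

removeAt-insertAt : ∀ p x l → p ≤ length l → removeAt p (insertAt p x l) ≡ l
removeAt-insertAt zero    x l       _         = refl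
removeAt-insertAt (suc p) x (a ∷ l) (s≤s p≤) = cong (a ∷_) (removeAt-insertAt p x l p≤)

insertAt-removeAt : ∀ p l → p < length l → insertAt p (nth l p) (removeAt p l) ≡ l
insertAt-removeAt zero    (a ∷ l) _         = refl
insertAt-removeAt (suc p) (a ∷ l) (s≤s p<) = cong (a ∷_) (insertAt-removeAt p l p<)

removeAt-↭ : ∀ p l → p < length l → l ↭ nth l p ∷ removeAt p l
removeAt-↭ zero    (a ∷ l) _         = ↭-refl
removeAt-↭ (suc p) (a ∷ l) (s≤s p<) = ↭-trans (↭-prep a (removeAt-↭ p l p<)) (↭-swap a (nth l p) ↭-refl)

length-setAt : ∀ p x l → length (setAt p x l) ≡ length l
length-setAt p       x []      = refl
length-setAt zero    x (a ∷ l) = refl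
length-setAt (suc p) x (a ∷ l) = cong suc (length-setAt p x l)

setAt-setAt : ∀ p x y l → setAt p y (setAt p x l) ≡ setAt p y l
setAt-setAt p       x y []      = refl
setAt-setAt zero    x y (a ∷ l) = refl
setAt-setAt (suc p) x y (a ∷ l) = cong (a ∷_) (setAt-setAt p x y l)

setAt-nthOr : ∀ d p l → setAt p (nthOr d l p) l ≡ l
setAt-nthOr d p       []      = refl
setAt-nthOr d zero    (a ∷ l) = refl
setAt-nthOr d (suc p) (a ∷ l) = cong (a ∷_) (setAt-nthOr d p l)

length-∷ʳ : ∀ (l : List ℕ) x → length (l ++ [ x ]) ≡ suc (length l)
length-∷ʳ []      x = refl
length-∷ʳ (a ∷ l) x = cong suc (length-∷ʳ l x)

init-∷ʳ : ∀ l x → init (l ++ [ x ]) ≡ l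
init-∷ʳ []          x = refl
init-∷ʳ (a ∷ [])    x = refl
init-∷ʳ (a ∷ b ∷ l) x = cong (a ∷_) (init-∷ʳ (b ∷ l) x)

lastOr-∷ʳ : ∀ d l x → lastOr d (l ++ [ x ]) ≡ x
lastOr-∷ʳ d []          x = refl
lastOr-∷ʳ d (a ∷ [])    x = refl
lastOr-∷ʳ d (a ∷ b ∷ l) x = lastOr-∷ʳ d (b ∷ l) x

init-∷ʳ-lastOr : ∀ d a l → init (a ∷ l) ++ [ lastOr d (a ∷ l) ] ≡ a ∷ l
init-∷ʳ-lastOr d a []      = refl
init-∷ʳ-lastOr d a (b ∷ l) = cong (a ∷_) (init-∷ʳ-lastOr d b l)

∷ʳ-↭ : ∀ (l : List ℕ) x → l ++ [ x ] ↭ x ∷ l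
∷ʳ-↭ []      x = ↭-refl
∷ʳ-↭ (a ∷ l) x = ↭-trans (↭-prep a (∷ʳ-↭ l x)) (↭-swap a x ↭-refl)

-- Permutations in one-line notation

IsPermutation : ℕ → List ℕ → Set
IsPermutation n l = Unique l × All (_< n) l × length l ≡ n

Unique-resp-↭ : ∀ {l l′ : List ℕ} → l ↭ l′ → Unique l → Unique l′
Unique-resp-↭ ↭.refl          u                     = u
Unique-resp-↭ (↭.prep x σ)    (x∉ ∷ u)              = All-resp-↭ σ x∉ ∷ Unique-resp-↭ σ u
Unique-resp-↭ (↭.swap x y σ)  ((x≢y ∷ x∉) ∷ y∉ ∷ u) =
  ((λ e → x≢y (sym e)) ∷ All-resp-↭ σ y∉) ∷ All-resp-↭ σ x∉ ∷ Unique-resp-↭ σ u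
Unique-resp-↭ (↭.trans σ σ′)  u                     = Unique-resp-↭ σ′ (Unique-resp-↭ σ u)

IsPermutation-↭ : ∀ {n l l′} → IsPermutation n l → l ↭ l′ → IsPermutation n l′
IsPermutation-↭ (u , bounded , len) σ = Unique-resp-↭ σ u , All-resp-↭ σ bounded , trans (sym (↭-length σ)) len

IsPermutation-∷ : ∀ {m h l} → IsPermutation m l → h < suc m → All (h ≢_) l → IsPermutation (suc m) (h ∷ l)
IsPermutation-∷ (u , bounded , len) h<1+m h∉ = (h∉ ∷ u) , (h<1+m ∷ All.map m≤n⇒m≤1+n bounded) , cong suc len

punchOut-word : ∀ {m h l} → h ≤ m → All (_≢ h) l → All (_< suc m) l → Unique l →
                Unique (map (punchOut h) l) × All (_< m) (map (punchOut h) l)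
punchOut-word {h = h} h≤m l≢h bounded u =
  Unique-map⁺ (punchOut h) (λ (x≢h , _) (y≢h , _) → punchOut-injective h x≢h y≢h) both u ,
  All-map⁺ (All.map (λ (x≢h , x<) → punchOut-bound h≤m x≢h x<) both)
  where both = All.zip (l≢h , bounded)

length-bound : ∀ n l → Unique l → All (_< n) l → length l ≤ n
length-bound n       []      _        _              = z≤n
length-bound (suc n) (a ∷ l) (a∉ ∷ u) (a<1+n ∷ bounded) =
  let (u′ , bounded′) = punchOut-word (≤-pred a<1+n) (All.map (λ a≢x x≡a → a≢x (sym x≡a)) a∉) bounded u
  in s≤s (subst (_≤ n) (length-map (punchOut a) l) (length-bound n _ u′ bounded′))

-- Otherwise punching v out would leave n distinct values below n - 1.
IsPermutation-∈ : ∀ {n l v} → IsPermutation n l → v < n → v ∈ l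
IsPermutation-∈ {suc n} {l} {v} (u , bounded , len) v<1+n with v ∈? l
... | yes v∈l = v∈l
... | no  v∉l =
  let l≢v = ¬Any⇒All¬ l (λ v∈ → v∉l (Any.map sym v∈))
      (u′ , bounded′) = punchOut-word (≤-pred v<1+n) l≢v bounded u
  in ⊥-elim (<-irrefl refl (subst (_≤ n) (trans (length-map (punchOut v) l) len) (length-bound n _ u′ bounded′)))

occurrences : ℕ → List ℕ → ℕ
occurrences v []      = 0
occurrences v (a ∷ l) = 𝟙 (does (a ≟ℕ v)) + occurrences v l

occurrences-∉ : ∀ v l → All (v ≢_) l → occurrences v l ≡ 0
occurrences-∉ v []      _          = refl
occurrences-∉ v (a ∷ l) (v≢a ∷ v∉) rewrite ≟-false (λ a≡v → v≢a (sym a≡v)) = occurrences-∉ v l v∉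

occurrences-∈ : ∀ v l → Unique l → v ∈ l → occurrences v l ≡ 1
occurrences-∈ v (a ∷ l) (a∉ ∷ u) (here refl)  rewrite ≟-true {v} refl = cong suc (occurrences-∉ v l a∉)
occurrences-∈ v (a ∷ l) (a∉ ∷ u) (there v∈l)
  rewrite ≟-false (λ v≡a → All.lookup a∉ (subst (_∈ l) (sym v≡a) v∈l) refl) = occurrences-∈ v l u v∈l

if≋scale-𝟙 : ∀ b (R : Poly) → (if b then R else []) ≋ scale (𝟙 b) R
if≋scale-𝟙 true  R = ≋-sym (scale-one R)
if≋scale-𝟙 false R = ≋-sym (scale-zero R)

sumTo-positions : ∀ v (R : Poly) m l → length l ≡ suc m →
                  sumTo m (λ p → if does (nth l p ≟ℕ v) then R else []) ≋ scale (occurrences v l) R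
sumTo-positions v R zero    (a ∷ [])    _ =
  ≋-trans (if≋scale-𝟙 (does (a ≟ℕ v)) R) (scale-congˡ R (sym (+-identityʳ (𝟙 (does (a ≟ℕ v))))))
sumTo-positions v R (suc m) (a ∷ l) len = begin
  sumTo (suc m) (λ p → if does (nth (a ∷ l) p ≟ℕ v) then R else [])
    ≈⟨ sumTo-unfoldˡ m (λ p → if does (nth (a ∷ l) p ≟ℕ v) then R else []) ⟩
  (if does (a ≟ℕ v) then R else []) ⊕ sumTo m (λ p → if does (nth l p ≟ℕ v) then R else [])
    ≈⟨ ⊕-cong (if≋scale-𝟙 (does (a ≟ℕ v)) R) (sumTo-positions v R m l (cong pred len)) ⟩
  scale (𝟙 (does (a ≟ℕ v))) R ⊕ scale (occurrences v l) R
    ≈⟨ scale-distribʳ (𝟙 (does (a ≟ℕ v))) (occurrences v l) R ⟨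
  scale (occurrences v (a ∷ l)) R ∎
  where open ≋-Reasoning

sumOver-split-max : ∀ m (L : List (List ℕ)) → (∀ l → l ∈ L → IsPermutation (suc m) l) →
  (F : List ℕ → Poly) →
  sumOver L F ≋ sumTo m (λ p → sumOver L (λ l → if does (nth l p ≟ℕ m) then F l else []))
sumOver-split-max m L perm F =
  ≋-trans (sumOver-cong L (λ l l∈L → ≋-sym (once l (perm l l∈L))))
          (sumOver-sumTo L m (λ l p → if does (nth l p ≟ℕ m) then F l else []))
  where
  once : ∀ l → IsPermutation (suc m) l → sumTo m (λ p → if does (nth l p ≟ℕ m) then F l else []) ≋ F l
  once l π@(u , _ , len) = ≋-trans (sumTo-positions m (F l) m l len)
    (≋-trans (scale-congˡ (F l) (occurrences-∈ m l u (IsPermutation-∈ π ≤-refl))) (scale-one (F l)))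

oneLine : ∀ {n k} → Vec (Fin n) k → List ℕ
oneLine w = map toℕ (toList w)

𝔖 : ℕ → List (List ℕ)
𝔖 n = map oneLine (perms n)

distinct? : ∀ {n} (v : Vec (Fin n) n) → Dec (Unique (toList v))
distinct? v = UniqueDec.unique? Fin._≟_ (toList v)

toList-allFin : ∀ m → toList (Vec.allFin m) ≡ List.allFin m
toList-allFin m = toList-tabulate id
  where
  toList-tabulate : ∀ {k} (f : Fin k → Fin m) → toList (Vec.tabulate f) ≡ List.tabulate f
  toList-tabulate {zero}  f = refl
  toList-tabulate {suc k} f = cong (f Fin.zero ∷_) (toList-tabulate (f ∘ Fin.suc))

words-cartesian : ∀ n m → words (suc n) m ≡ cartesianProductWith (λ v a → a ∷ v) (words n m) (List.allFin m)
words-cartesian n m = go (words n m)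
  where
  go : ∀ ws → concatMap (λ v → map (_∷ v) (toList (Vec.allFin m))) ws
              ≡ cartesianProductWith (λ v a → a ∷ v) ws (List.allFin m)
  go []       = refl
  go (w ∷ ws) = cong₂ _++_ (cong (map (_∷ w)) (toList-allFin m)) (go ws)

words-unique : ∀ n m → Unique (words n m)
words-unique zero    m = [] ∷ []
words-unique (suc n) m = subst Unique (sym (words-cartesian n m))
  (Unique.cartesianProductWith⁺ (λ v a → a ∷ v) (λ e → let (a≡ , v≡) = Vec.∷-injective e in v≡ , a≡)
                                (words-unique n m) (Unique.allFin⁺ m))

∈-words : ∀ n m (v : Vec (Fin m) n) → v ∈ words n m
∈-words zero    m []      = here refl
∈-words (suc n) m (a ∷ v) = subst (a ∷ v ∈_) (sym (words-cartesian n m))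
  (∈-cartesianProductWith⁺ (λ v a → a ∷ v) (∈-words n m v) (∈-allFin a))

oneLine-injective : ∀ {n k} (w w′ : Vec (Fin n) k) → oneLine w ≡ oneLine w′ → w ≡ w′
oneLine-injective []      []        _ = refl
oneLine-injective (a ∷ w) (b ∷ w′) e =
  cong₂ _∷_ (Fin.toℕ-injective (List.∷-injectiveˡ e)) (oneLine-injective w w′ (List.∷-injectiveʳ e))

𝔖-unique : ∀ n → Unique (𝔖 n)
𝔖-unique n = Unique.map⁺ (λ {w} {w′} → oneLine-injective w w′)
                         (Unique.filter⁺ distinct? (words-unique n n))

oneLine-bounded : ∀ {n k} (w : Vec (Fin n) k) → All (_< n) (oneLine w)
oneLine-bounded []      = []
oneLine-bounded (a ∷ w) = Fin.toℕ<n a ∷ oneLine-bounded w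

length-oneLine : ∀ {n k} (w : Vec (Fin n) k) → length (oneLine w) ≡ k
length-oneLine []      = refl
length-oneLine (a ∷ w) = cong suc (length-oneLine w)

∈𝔖⇒IsPermutation : ∀ {n l} → l ∈ 𝔖 n → IsPermutation n l
∈𝔖⇒IsPermutation {n} l∈ with ∈-map⁻ oneLine l∈
... | w , w∈ , refl =
  Unique.map⁺ Fin.toℕ-injective (proj₂ (∈-filter⁻ distinct? {xs = words n n} w∈)) ,
  oneLine-bounded w , length-oneLine w

IsPermutation⇒∈𝔖 : ∀ {n l} → IsPermutation n l → l ∈ 𝔖 n
IsPermutation⇒∈𝔖 {n} {l} (u , bounded , len) =
  subst (_∈ 𝔖 n) oneLine-w (∈-map⁺ oneLine (∈-filter⁺ distinct? (∈-words n n w) w-unique))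
  where
  fromOneLine : ∀ l → All (_< n) l → Vec (Fin n) (length l)
  fromOneLine []      []                = []
  fromOneLine (a ∷ l) (a<n ∷ bounded) = Fin.fromℕ< a<n ∷ fromOneLine l bounded
  oneLine-fromOneLine : ∀ l (bounded : All (_< n) l) → oneLine (fromOneLine l bounded) ≡ l
  oneLine-fromOneLine []      []                = refl
  oneLine-fromOneLine (a ∷ l) (a<n ∷ bounded) = cong₂ _∷_ (Fin.toℕ-fromℕ< a<n) (oneLine-fromOneLine l bounded)
  oneLine-subst : ∀ {k k′} (e : k ≡ k′) (v : Vec (Fin n) k) → oneLine (subst (Vec (Fin n)) e v) ≡ oneLine v
  oneLine-subst refl v = refl
  w : Vec (Fin n) n
  w = subst (Vec (Fin n)) len (fromOneLine l bounded)
  oneLine-w : oneLine w ≡ l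
  oneLine-w = trans (oneLine-subst len (fromOneLine l bounded)) (oneLine-fromOneLine l bounded)
  w-unique : Unique (toList w)
  w-unique = Unique.map⁻ (subst Unique (sym oneLine-w) u)

des-oneLine : ∀ {n} (w : Vec (Fin n) n) → des w ≡ desᴸ (oneLine w)
des-oneLine w = go (toList w)
  where
  go : ∀ {m} (L : List (Fin m)) → desL L ≡ desᴸ (map toℕ L)
  go []          = refl
  go (a ∷ [])    = refl
  go (a ∷ b ∷ L) = cong (𝟙 (toℕ b <ᵇ toℕ a) +_) (go (b ∷ L))

sumFin : ∀ k → (Fin k → ℕ) → ℕ
sumFin zero    f = 0
sumFin (suc k) f = f Fin.zero + sumFin k (f ∘ Fin.suc)

count-oneLine : ∀ {n} (B : ℕ → ℕ → Bool) (w : Vec (Fin n) n) (P : Fin n → Bool) →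
                (∀ i → P i ≡ B (toℕ i) (toℕ (Vec.lookup w i))) →
                count P ≡ positional (λ i a → 𝟙 (B i a)) 0 (oneLine w)
count-oneLine {n} B w P P≡B = trans (foldr-tabulate id)
  (trans (sumFin-cong n (λ i → cong 𝟙 (P≡B i))) (sumFin-positional 0 w))
  where
  foldr-tabulate : ∀ {k} (g : Fin k → Fin n) →
                   foldr (λ i r → 𝟙 (P i) + r) 0 (toList (Vec.tabulate g)) ≡ sumFin k (λ i → 𝟙 (P (g i)))
  foldr-tabulate {zero}  g = refl
  foldr-tabulate {suc k} g = cong (𝟙 (P (g Fin.zero)) +_) (foldr-tabulate (g ∘ Fin.suc))
  sumFin-cong : ∀ k {f g : Fin k → ℕ} → (∀ i → f i ≡ g i) → sumFin k f ≡ sumFin k g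
  sumFin-cong zero    e = refl
  sumFin-cong (suc k) e = cong₂ _+_ (e Fin.zero) (sumFin-cong k (e ∘ Fin.suc))
  sumFin-positional : ∀ {k} t (v : Vec (Fin n) k) →
    sumFin k (λ i → 𝟙 (B (t + toℕ i) (toℕ (Vec.lookup v i)))) ≡ positional (λ i a → 𝟙 (B i a)) t (oneLine v)
  sumFin-positional t []      = refl
  sumFin-positional {suc k} t (a ∷ v) = cong₂ _+_ (cong (λ s → 𝟙 (B s (toℕ a))) (+-identityʳ t))
    (trans (sumFin-cong k (λ i → cong (λ s → 𝟙 (B s (toℕ (Vec.lookup v i)))) (+-suc t (toℕ i))))
           (sumFin-positional (suc t) v))

exc-oneLine : ∀ {n} (w : Vec (Fin n) n) → exc w ≡ excᴸ 0 (oneLine w)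
exc-oneLine w = count-oneLine (λ i a → i <ᵇ a) w _ (λ _ → refl)

fixk-oneLine : ∀ {n} k (w : Vec (Fin n) n) → fixk k w ≡ fixᴸ k 0 (oneLine w)
fixk-oneLine k w = count-oneLine (λ i a → does (a ≟ℕ i) ∧ (i <ᵇ k)) w _
  (λ i → cong (_∧ (toℕ i <ᵇ k)) (≟ᶠ-toℕ (Vec.lookup w i) i))
  where
  ≟ᶠ-toℕ : ∀ {n} (x y : Fin n) → does (x Fin.≟ y) ≡ does (toℕ x ≟ℕ toℕ y)
  ≟ᶠ-toℕ x y with x Fin.≟ y
  ... | yes x≡y = sym (≟-true (cong toℕ x≡y))
  ... | no  x≢y = sym (≟-false (λ e → x≢y (Fin.toℕ-injective e)))

sumOver-𝔖-bijection : ∀ {m m′} {P : Pred (List ℕ) 0ℓ} (P? : Decidable P) (φ ψ : List ℕ → List ℕ) →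
  (∀ {l} → IsPermutation m l → IsPermutation m′ (φ l) × P (φ l)) →
  (∀ {l} → IsPermutation m′ l → P l → IsPermutation m (ψ l)) →
  (∀ {l} → IsPermutation m l → ψ (φ l) ≡ l) →
  (∀ {l} → IsPermutation m′ l → P l → φ (ψ l) ≡ l) →
  (F : List ℕ → Poly) → sumOver (𝔖 m) (F ∘ φ) ≋ sumOver (𝔖 m′) (λ l → if does (P? l) then F l else [])
sumOver-𝔖-bijection {m} {m′} {P} P? φ ψ φ-perm ψ-perm ψ∘φ φ∘ψ F =
  ≋-trans (sumOver-bijection φ ψ (𝔖-unique m) (Unique.filter⁺ P? (𝔖-unique m′)) φ∈ ψ∈
            (ψ∘φ ∘ ∈𝔖⇒IsPermutation) (λ l∈ → uncurry φ∘ψ (target l∈)) F)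
          (sumOver-filter P? (𝔖 m′) F)
  where
  target : ∀ {l} → l ∈ filter P? (𝔖 m′) → IsPermutation m′ l × P l
  target l∈ = let (l∈𝔖 , Pl) = ∈-filter⁻ P? l∈ in ∈𝔖⇒IsPermutation l∈𝔖 , Pl
  φ∈ : ∀ {l} → l ∈ 𝔖 m → φ l ∈ filter P? (𝔖 m′)
  φ∈ l∈ = let (π , Pφl) = φ-perm (∈𝔖⇒IsPermutation l∈) in ∈-filter⁺ P? (IsPermutation⇒∈𝔖 π) Pφl
  ψ∈ : ∀ {l} → l ∈ filter P? (𝔖 m′) → ψ l ∈ 𝔖 m
  ψ∈ l∈ = IsPermutation⇒∈𝔖 (uncurry ψ-perm (target l∈))

IsPermutation-punchIn : ∀ {m h l} → h ≤ m → IsPermutation m l → IsPermutation (suc m) (h ∷ map (punchIn h) l)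
IsPermutation-punchIn {h = h} {l} h≤m (u , bounded , len) =
  (All-map⁺ (All.tabulate (λ {a} _ e → punchIn-≢ h a (sym e))) ∷ Unique.map⁺ (punchIn-injective h) u) ,
  (s≤s h≤m ∷ All-map⁺ (All.map (punchIn-bound {h}) bounded)) ,
  cong suc (trans (length-map (punchIn h) l) len)

IsPermutation-punchOut : ∀ {m h r} → h ≤ m → IsPermutation (suc m) (h ∷ r) → IsPermutation m (map (punchOut h) r)
IsPermutation-punchOut {h = h} {r} h≤m (h∉ ∷ u , _ ∷ bounded , len) =
  let (u′ , bounded′) = punchOut-word h≤m (All.map (λ h≢x x≡h → h≢x (sym x≡h)) h∉) bounded u
  in u′ , bounded′ , trans (length-map (punchOut h) r) (cong pred len)

IsPermutation-max∷ : ∀ {m l} → IsPermutation m l → IsPermutation (suc m) (m ∷ l)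
IsPermutation-max∷ π@(_ , bounded , _) =
  IsPermutation-∷ π ≤-refl (All.map (λ x<m m≡x → <-irrefl (sym m≡x) x<m) bounded)

IsPermutation-dropMax : ∀ {m r} → IsPermutation (suc m) (m ∷ r) → IsPermutation m r
IsPermutation-dropMax (m∉ ∷ u , _ ∷ bounded , len) =
  u , All.zipWith (λ (m≢x , x<1+m) → ≤∧≢⇒< (≤-pred x<1+m) (m≢x ∘ sym)) (m∉ , bounded) , cong pred len

IsPermutation-removeAt : ∀ {n l p} → IsPermutation n l → p < n → IsPermutation n (nth l p ∷ removeAt p l)
IsPermutation-removeAt {l = l} {p} π@(_ , _ , len) p<n = IsPermutation-↭ π (removeAt-↭ p l (subst (p <_) (sym len) p<n))

sumOver-insert : ∀ m p h → p ≤ m → h ≤ m → (F : List ℕ → Poly) →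
  sumOver (𝔖 m) (λ l → F (insertAt p h (map (punchIn h) l)))
    ≋ sumOver (𝔖 (suc m)) (λ l → if does (nth l p ≟ℕ h) then F l else [])
sumOver-insert m p h p≤m h≤m =
  sumOver-𝔖-bijection (λ l → nth l p ≟ℕ h) φ ψ φ-perm ψ-perm ψ∘φ φ∘ψ
  where
  φ ψ : List ℕ → List ℕ
  φ l = insertAt p h (map (punchIn h) l)
  ψ l = map (punchOut h) (removeAt p l)
  p≤length : ∀ l → length l ≡ m → p ≤ length (map (punchIn h) l)
  p≤length l len = subst (p ≤_) (sym (trans (length-map (punchIn h) l) len)) p≤m
  φ-perm : ∀ {l} → IsPermutation m l → IsPermutation (suc m) (φ l) × nth (φ l) p ≡ h
  φ-perm {l} π@(_ , _ , len) =
    IsPermutation-↭ (IsPermutation-punchIn h≤m π) (↭-sym (insertAt-↭ p h (map (punchIn h) l))) ,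
    nth-insertAt p h (map (punchIn h) l) (p≤length l len)
  removed : ∀ {l} → IsPermutation (suc m) l → nth l p ≡ h → IsPermutation (suc m) (h ∷ removeAt p l)
  removed π refl = IsPermutation-removeAt π (s≤s p≤m)
  ψ-perm : ∀ {l} → IsPermutation (suc m) l → nth l p ≡ h → IsPermutation m (ψ l)
  ψ-perm π e = IsPermutation-punchOut h≤m (removed π e)
  ψ∘φ : ∀ {l} → IsPermutation m l → ψ (φ l) ≡ l
  ψ∘φ {l} (_ , _ , len) =
    trans (cong (map (punchOut h)) (removeAt-insertAt p h _ (p≤length l len))) (map-punchOut-punchIn h l)
  φ∘ψ : ∀ {l} → IsPermutation (suc m) l → nth l p ≡ h → φ (ψ l) ≡ l
  φ∘ψ {l} π@(_ , _ , len) e with removed π e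
  ... | h∉ ∷ _ , _ = begin
    insertAt p h (map (punchIn h) (map (punchOut h) (removeAt p l)))
      ≡⟨ cong (insertAt p h) (map-punchIn-punchOut h (removeAt p l) (All.map (λ h≢a a≡h → h≢a (sym a≡h)) h∉)) ⟩
    insertAt p h (removeAt p l)
      ≡⟨ cong (λ x → insertAt p x (removeAt p l)) e ⟨
    insertAt p (nth l p) (removeAt p l)
      ≡⟨ insertAt-removeAt p l (subst (p <_) (sym len) (s≤s p≤m)) ⟩
    l ∎
    where open ≡-Reasoning

-- In cycle notation, cycle p m inserts the new value m into the cycle of p, right after p
-- (as a fixed point when p = m).
cycle : ℕ → ℕ → List ℕ → List ℕ
cycle p M l = setAt p M l ++ [ nthOr M l p ]

cycle-↭ : ∀ p M l → p ≤ length l → cycle p M l ↭ M ∷ l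
cycle-↭ zero    M []      _         = ↭-refl
cycle-↭ zero    M (a ∷ l) _         = ↭-prep M (∷ʳ-↭ l a)
cycle-↭ (suc p) M (a ∷ l) (s≤s p≤) = ↭-trans (↭-prep a (cycle-↭ p M l p≤)) (↭-swap a M ↭-refl)

nth-cycle : ∀ p M l → p ≤ length l → nth (cycle p M l) p ≡ M
nth-cycle zero    M []      _         = refl
nth-cycle zero    M (a ∷ l) _         = refl
nth-cycle (suc p) M (a ∷ l) (s≤s p≤) = nth-cycle p M l p≤

cycle-setAt : ∀ p M v l → p ≤ length l → nthOr v l p ≡ M → cycle p M (setAt p v l) ≡ l ++ [ v ]
cycle-setAt zero    M v []      _         v≡M = cong [_] (sym v≡M)
cycle-setAt zero    M v (a ∷ l) _         a≡M = cong (λ x → x ∷ l ++ [ v ]) (sym a≡M)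
cycle-setAt (suc p) M v (a ∷ l) (s≤s p≤) e   = cong (a ∷_) (cycle-setAt p M v l p≤ e)

nth-∷ʳ : ∀ p v l → p ≤ length l → nth (l ++ [ v ]) p ≡ nthOr v l p
nth-∷ʳ zero    v []      _         = refl
nth-∷ʳ zero    v (a ∷ l) _         = refl
nth-∷ʳ (suc p) v (a ∷ l) (s≤s p≤) = nth-∷ʳ p v l p≤

sumOver-cycle : ∀ m p → p ≤ m → (F : List ℕ → Poly) →
  sumOver (𝔖 m) (λ l → F (cycle p m l)) ≋ sumOver (𝔖 (suc m)) (λ l → if does (nth l p ≟ℕ m) then F l else [])
sumOver-cycle m p p≤m =
  sumOver-𝔖-bijection (λ l → nth l p ≟ℕ m) (cycle p m) ψ φ-perm ψ-perm ψ∘φ φ∘ψ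
  where
  ψ : List ℕ → List ℕ
  ψ l = setAt p (lastOr 0 l) (init l)
  φ-perm : ∀ {l} → IsPermutation m l → IsPermutation (suc m) (cycle p m l) × nth (cycle p m l) p ≡ m
  φ-perm {l} π@(_ , _ , len) =
    IsPermutation-↭ (IsPermutation-max∷ π) (↭-sym (cycle-↭ p m l (subst (p ≤_) (sym len) p≤m))) ,
    nth-cycle p m l (subst (p ≤_) (sym len) p≤m)
  ψ∘φ : ∀ {l} → IsPermutation m l → ψ (cycle p m l) ≡ l
  ψ∘φ {l} _ rewrite init-∷ʳ (setAt p m l) (nthOr m l p) | lastOr-∷ʳ 0 (setAt p m l) (nthOr m l p) =
    trans (setAt-setAt p m (nthOr m l p) l) (setAt-nthOr m p l)
  length-init : ∀ l → length l ≡ suc m → length (init l) ≡ m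
  length-init (a ∷ l) len =
    cong pred (trans (sym (length-∷ʳ (init (a ∷ l)) _)) (trans (cong length (init-∷ʳ-lastOr 0 a l)) len))
  φ∘ψ : ∀ {l} → IsPermutation (suc m) l → nth l p ≡ m → cycle p m (ψ l) ≡ l
  φ∘ψ {a ∷ l} (_ , _ , len) e =
    trans (cycle-setAt p m v L p≤L (trans (sym (nth-∷ʳ p v L p≤L)) (subst (λ l′ → nth l′ p ≡ m) (sym split) e)))
          split
    where
    L = init (a ∷ l)
    v = lastOr 0 (a ∷ l)
    split : L ++ [ v ] ≡ a ∷ l
    split = init-∷ʳ-lastOr 0 a l
    p≤L : p ≤ length L
    p≤L = subst (p ≤_) (sym (length-init (a ∷ l) len)) p≤m
  ψ-perm : ∀ {l} → IsPermutation (suc m) l → nth l p ≡ m → IsPermutation m (ψ l)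
  ψ-perm {l} π@(_ , _ , len) e =
    IsPermutation-dropMax (IsPermutation-↭ π (subst (_↭ m ∷ ψ l) (φ∘ψ π e) (cycle-↭ p m (ψ l) p≤ψ)))
    where
    p≤ψ : p ≤ length (ψ l)
    p≤ψ = subst (p ≤_) (sym (trans (length-setAt p _ (init l)) (length-init l len))) p≤m

sumOver-complement : ∀ m (F : List ℕ → Poly) → sumOver (𝔖 (suc m)) (F ∘ map (m ∸_)) ≋ sumOver (𝔖 (suc m)) F
sumOver-complement m = sumOver-𝔖-bijection (λ _ → yes tt) complement complement
  (λ π → complement-perm π , tt) (λ π _ → complement-perm π) involutive (λ π _ → involutive π)
  where
  complement = map (m ∸_)
  ∸-involutive : ∀ {a} → a < suc m → m ∸ (m ∸ a) ≡ a
  ∸-involutive a<1+m = m∸[m∸n]≡n (≤-pred a<1+m)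
  complement-perm : ∀ {l} → IsPermutation (suc m) l → IsPermutation (suc m) (complement l)
  complement-perm {l} (u , bounded , len) =
    Unique-map⁺ (m ∸_) (λ a< b< e → trans (sym (∸-involutive a<)) (trans (cong (m ∸_) e) (∸-involutive b<))) bounded u ,
    All-map⁺ (All.tabulate (λ {a} _ → s≤s (m∸n≤m m a))) ,
    trans (length-map (m ∸_) l) len
  involutive : ∀ {l} → IsPermutation (suc m) l → complement (complement l) ≡ l
  involutive {l} (_ , bounded , _) =
    trans (sym (List.map-∘ l)) (trans (map-cong-∈ (∸-involutive ∘ All.lookup bounded)) (List.map-id l))

-- Descents and excedances are equidistributed

-- (d + 1) g(d) + (m - d) g(d + 1): inserting a new largest value into the m + 1 slots of a
-- permutation of m letters with d descents keeps d descents in d + 1 slots and creates one in the others.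
eulerianStep : (ℕ → Poly) → ℕ → ℕ → Poly
eulerianStep g m d = scale (suc d) (g d) ⊕ scale (m ∸ d) (g (suc d))

eulerianStep-zero : ∀ g → eulerianStep g 0 0 ≋ g 0
eulerianStep-zero g = ≋-trans (⊕-cong (scale-one (g 0)) (scale-zero (g 1))) (⊕-identityʳ (g 0))

-- A new first letter adds one slot, contributing g(d + 1); e ∈ {0, 1} is the letter's own contribution.
eulerianStep-suc : ∀ (g : ℕ → Poly) e n d → e ≤ 1 → d ≤ n →
                   g (suc d) ⊕ eulerianStep (λ x → g (e + x)) n d ≋ eulerianStep g (suc n) (e + d)
eulerianStep-suc g zero n d _ d≤n = begin
  g (suc d) ⊕ (scale (suc d) (g d) ⊕ scale (n ∸ d) (g (suc d)))
    ≈⟨ ⊕-assoc (g (suc d)) _ _ ⟨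
  (g (suc d) ⊕ scale (suc d) (g d)) ⊕ scale (n ∸ d) (g (suc d))
    ≈⟨ ⊕-cong (⊕-comm (g (suc d)) _) ≋-refl ⟩
  (scale (suc d) (g d) ⊕ g (suc d)) ⊕ scale (n ∸ d) (g (suc d))
    ≈⟨ ⊕-assoc (scale (suc d) (g d)) _ _ ⟩
  scale (suc d) (g d) ⊕ (g (suc d) ⊕ scale (n ∸ d) (g (suc d)))
    ≈⟨ ⊕-congʳ (scale (suc d) (g d)) (scale-suc (n ∸ d) (g (suc d))) ⟨
  scale (suc d) (g d) ⊕ scale (suc (n ∸ d)) (g (suc d))
    ≈⟨ ⊕-congʳ (scale (suc d) (g d)) (scale-congˡ (g (suc d)) (sym (+-∸-assoc 1 d≤n))) ⟩
  scale (suc d) (g d) ⊕ scale (suc n ∸ d) (g (suc d)) ∎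
  where open ≋-Reasoning
eulerianStep-suc g (suc zero) n d _ d≤n =
  ≋-trans (≋-sym (⊕-assoc (g (suc d)) (scale (suc d) (g (suc d))) _))
          (⊕-cong (≋-sym (scale-suc (suc d) (g (suc d)))) ≋-refl)
eulerianStep-suc g (suc (suc e)) n d (s≤s ()) _

desᴸ-insertMax : ∀ (g : ℕ → Poly) M l → All (_< M) l →
                 sumTo (length l) (λ p → g (desᴸ (insertAt p M l))) ≋ eulerianStep g (length l) (desᴸ l)
desᴸ-insertMax g M []      _                = ≋-sym (eulerianStep-zero g)
desᴸ-insertMax g M (b ∷ l) (b<M ∷ bounded) =
  ≋-trans (sumTo-unfoldˡ (length l) (λ p → g (desᴸ (insertAt p M (b ∷ l)))))
  (≋-trans (⊕-cong (≡⇒≋ (cong (λ x → g (𝟙 x + desᴸ (b ∷ l))) (<ᵇ-true b<M))) (after g b l b<M bounded))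
           (eulerianStep-suc g 0 (length l) (desᴸ (b ∷ l)) z≤n (desᴸ-bound b l)))
  where
  after : ∀ (g : ℕ → Poly) a l → a < M → All (_< M) l →
          sumTo (length l) (λ p → g (desᴸ (a ∷ insertAt p M l))) ≋ eulerianStep g (length l) (desᴸ (a ∷ l))
  after g a []      a<M _                =
    ≋-trans (≡⇒≋ (cong (λ x → g (𝟙 x + 0)) (<ᵇ-false (<⇒≤ a<M)))) (≋-sym (eulerianStep-zero g))
  after g a (b ∷ l) a<M (b<M ∷ bounded) =
    ≋-trans (sumTo-unfoldˡ (length l) (λ p → g (desᴸ (a ∷ insertAt p M (b ∷ l)))))
    (≋-trans (⊕-cong (≡⇒≋ first) (after (λ x → g (e + x)) b l b<M bounded))
             (eulerianStep-suc g e (length l) (desᴸ (b ∷ l)) (𝟙≤1 (b <ᵇ a)) (desᴸ-bound b l)))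
    where
    e = 𝟙 (b <ᵇ a)
    first : g (desᴸ (a ∷ M ∷ b ∷ l)) ≡ g (suc (desᴸ (b ∷ l)))
    first rewrite <ᵇ-false (<⇒≤ a<M) | <ᵇ-true b<M = refl

excᴸ-setMax : ∀ (g : ℕ → Poly) i M l → i + length l ≤ M →
              sumTo (length l) (λ p → g (excᴸ i (setAt p M l))) ≋ eulerianStep g (length l) (excᴸ i l)
excᴸ-setMax g i M []      _ = ≋-sym (eulerianStep-zero g)
excᴸ-setMax g i M (a ∷ l) i+1+l≤M =
  ≋-trans (sumTo-unfoldˡ (length l) (λ p → g (excᴸ i (setAt p M (a ∷ l)))))
  (≋-trans (⊕-cong (≡⇒≋ first) (excᴸ-setMax (λ x → g (e + x)) (suc i) M l i+1+l≤M′))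
           (eulerianStep-suc g e (length l) (excᴸ (suc i) l) (𝟙≤1 (i <ᵇ a)) (excᴸ-bound (suc i) l)))
  where
  e = 𝟙 (i <ᵇ a)
  i+1+l≤M′ : suc i + length l ≤ M
  i+1+l≤M′ = subst (_≤ M) (+-suc i (length l)) i+1+l≤M
  first : g (excᴸ i (M ∷ l)) ≡ g (suc (excᴸ (suc i) l))
  first = cong (λ x → g (𝟙 x + excᴸ (suc i) l)) (<ᵇ-true (≤-trans (s≤s (m≤m+n i (length l))) i+1+l≤M′))

excᴸ-∷ʳ : ∀ i l x → excᴸ i (l ++ [ x ]) ≡ excᴸ i l + 𝟙 ((i + length l) <ᵇ x)
excᴸ-∷ʳ i []      x rewrite +-identityʳ i = +-identityʳ _
excᴸ-∷ʳ i (a ∷ l) x rewrite +-suc i (length l) =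
  trans (cong (𝟙 (i <ᵇ a) +_) (excᴸ-∷ʳ (suc i) l x)) (sym (+-assoc (𝟙 (i <ᵇ a)) _ _))

-- The displaced value lands in the last position m, where it is no excedance.
excᴸ-cycle : ∀ m l → IsPermutation m l → ∀ p → excᴸ 0 (cycle p m l) ≡ excᴸ 0 (setAt p m l)
excᴸ-cycle m l (_ , bounded , len) p = begin
  excᴸ 0 (cycle p m l)
    ≡⟨ excᴸ-∷ʳ 0 (setAt p m l) (nthOr m l p) ⟩
  excᴸ 0 (setAt p m l) + 𝟙 (length (setAt p m l) <ᵇ nthOr m l p)
    ≡⟨ cong (λ x → excᴸ 0 (setAt p m l) + 𝟙 (x <ᵇ nthOr m l p)) (trans (length-setAt p m l) len) ⟩
  excᴸ 0 (setAt p m l) + 𝟙 (m <ᵇ nthOr m l p)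
    ≡⟨ cong (λ x → excᴸ 0 (setAt p m l) + 𝟙 x) (<ᵇ-false (nthOr-≤ p l bounded)) ⟩
  excᴸ 0 (setAt p m l) + 0
    ≡⟨ +-identityʳ _ ⟩
  excᴸ 0 (setAt p m l) ∎
  where
  open ≡-Reasoning
  nthOr-≤ : ∀ p l → All (_< m) l → nthOr m l p ≤ m
  nthOr-≤ p       []      _              = ≤-refl
  nthOr-≤ zero    (a ∷ l) (a<m ∷ _)      = <⇒≤ a<m
  nthOr-≤ (suc p) (a ∷ l) (_ ∷ bounded) = nthOr-≤ p l bounded

sumOver-𝔖-des-step : ∀ m (g : ℕ → Poly) →
  sumOver (𝔖 (suc m)) (g ∘ desᴸ) ≋ sumOver (𝔖 m) (eulerianStep g m ∘ desᴸ)
sumOver-𝔖-des-step m g =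
  ≋-trans (sumOver-split-max m (𝔖 (suc m)) (λ _ → ∈𝔖⇒IsPermutation) (g ∘ desᴸ))
  (≋-trans (sumTo-cong m (λ p p≤m → ≋-sym (sumOver-insert m p m p≤m ≤-refl (g ∘ desᴸ))))
  (≋-trans (≋-sym (sumOver-sumTo (𝔖 m) m (λ l p → g (desᴸ (insertAt p m (map (punchIn m) l))))))
           (sumOver-cong (𝔖 m) (λ l l∈ → slots l (∈𝔖⇒IsPermutation l∈)))))
  where
  slots : ∀ l → IsPermutation m l →
          sumTo m (λ p → g (desᴸ (insertAt p m (map (punchIn m) l)))) ≋ eulerianStep g m (desᴸ l)
  slots l (_ , bounded , refl) rewrite map-punchIn-id l bounded = desᴸ-insertMax g m l bounded

sumOver-𝔖-exc-step : ∀ m (g : ℕ → Poly) →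
  sumOver (𝔖 (suc m)) (g ∘ excᴸ 0) ≋ sumOver (𝔖 m) (eulerianStep g m ∘ excᴸ 0)
sumOver-𝔖-exc-step m g =
  ≋-trans (sumOver-split-max m (𝔖 (suc m)) (λ _ → ∈𝔖⇒IsPermutation) (g ∘ excᴸ 0))
  (≋-trans (sumTo-cong m (λ p p≤m → ≋-sym (sumOver-cycle m p p≤m (g ∘ excᴸ 0))))
  (≋-trans (≋-sym (sumOver-sumTo (𝔖 m) m (λ l p → g (excᴸ 0 (cycle p m l)))))
           (sumOver-cong (𝔖 m) (λ l l∈ → slots l (∈𝔖⇒IsPermutation l∈)))))
  where
  slots : ∀ l → IsPermutation m l → sumTo m (λ p → g (excᴸ 0 (cycle p m l))) ≋ eulerianStep g m (excᴸ 0 l)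
  slots l π@(_ , _ , refl) =
    ≋-trans (sumTo-cong m (λ p _ → ≡⇒≋ (cong g (excᴸ-cycle m l π p)))) (excᴸ-setMax g 0 m l ≤-refl)

-- Both statistics obey the same recursion, so induction with g generalised gives equidistribution.
exc-des-equidistributed : ∀ n (g : ℕ → Poly) → sumOver (𝔖 n) (g ∘ excᴸ 0) ≋ sumOver (𝔖 n) (g ∘ desᴸ)
exc-des-equidistributed zero    g = sumOver-cong (𝔖 0) (λ l l∈ → empty (∈𝔖⇒IsPermutation l∈))
  where
  empty : ∀ {l} → IsPermutation 0 l → g (excᴸ 0 l) ≋ g (desᴸ l)
  empty {[]} _ = ≋-refl
exc-des-equidistributed (suc m) g =
  ≋-trans (sumOver-𝔖-exc-step m g)
  (≋-trans (exc-des-equidistributed m (eulerianStep g m)) (≋-sym (sumOver-𝔖-des-step m g)))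

-- Eulerian polynomials and the polynomials p_{m,j}

A≡sumOver-𝔖 : ∀ n → A n ≡ sumOver (𝔖 n) (xpow ∘ desᴸ)
A≡sumOver-𝔖 n =
  trans (sumOver-≡ (perms n) (cong xpow ∘ des-oneLine)) (sym (sumOver-map oneLine (perms n) (xpow ∘ desᴸ)))

coeff-xpow : ∀ e d → coeff (xpow e) d ≡ 𝟙 (does (e ≟ℕ d))
coeff-xpow zero    zero    = refl
coeff-xpow zero    (suc d) = refl
coeff-xpow (suc e) zero    = at (X⊗≋∷ (xpow e)) zero
coeff-xpow (suc e) (suc d) = trans (at (X⊗≋∷ (xpow e)) (suc d)) (coeff-xpow e d)

DegreeBelow-xpow : ∀ e → DegreeBelow (xpow e) (suc e)
DegreeBelow-xpow e = DegreeBelow-resp-≋ (xpow≋shift e)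
  (subst (DegreeBelow (shift e one)) (+-comm e 1) (DegreeBelow-shift e (DegreeBelow-∷ (mkDeg λ _ _ → refl))))

desᴸ-< : ∀ {m l} → IsPermutation (suc m) l → desᴸ l ≤ m
desᴸ-< {l = a ∷ l} (_ , _ , len) = subst (desᴸ (a ∷ l) ≤_) (cong pred len) (desᴸ-bound a l)

A-degree : ∀ n → DegreeBelow (A (suc n)) (suc n)
A-degree n = subst (λ P → DegreeBelow P (suc n)) (sym (A≡sumOver-𝔖 (suc n)))
  (DegreeBelow-sumOver (𝔖 (suc n)) λ l l∈ →
    DegreeBelow-mono (s≤s (desᴸ-< (∈𝔖⇒IsPermutation l∈))) (DegreeBelow-xpow (desᴸ l)))

-- Each adjacent pair is a descent of exactly one of l and its complement.
desᴸ-complement : ∀ m l → All (_≤ m) l → Unique l → desᴸ (map (m ∸_) l) + desᴸ l ≡ length l ∸ 1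
desᴸ-complement m []          _                  _                  = refl
desᴸ-complement m (a ∷ [])    _                  _                  = refl
desᴸ-complement m (a ∷ b ∷ l) (a≤m ∷ b≤m ∷ bounded) ((a≢b ∷ _) ∷ u) = begin
  (𝟙 ((m ∸ b) <ᵇ (m ∸ a)) + desᴸ (map (m ∸_) (b ∷ l))) + (𝟙 (b <ᵇ a) + desᴸ (b ∷ l))
    ≡⟨ interchange (𝟙 ((m ∸ b) <ᵇ (m ∸ a))) _ _ _ ⟩
  (𝟙 ((m ∸ b) <ᵇ (m ∸ a)) + 𝟙 (b <ᵇ a)) + (desᴸ (map (m ∸_) (b ∷ l)) + desᴸ (b ∷ l))
    ≡⟨ cong₂ _+_ exactly-one (desᴸ-complement m (b ∷ l) (b≤m ∷ bounded) u) ⟩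
  suc (length l) ∎
  where
  open ≡-Reasoning
  exactly-one : 𝟙 ((m ∸ b) <ᵇ (m ∸ a)) + 𝟙 (b <ᵇ a) ≡ 1
  exactly-one with compare<ᵇ b a
  ... | lt b<a e rewrite e | <ᵇ-false (<⇒≤ (∸-monoʳ-< {m} b<a a≤m))                     = refl
  ... | ge a≤b e rewrite e | <ᵇ-true (∸-monoʳ-< {m} (≤∧≢⇒< a≤b a≢b) b≤m) = refl

A-palindromic : ∀ m d → d ≤ m → coeff (A (suc m)) (m ∸ d) ≡ coeff (A (suc m)) d
A-palindromic m d d≤m = begin
  coeff (A (suc m)) (m ∸ d)
    ≡⟨ cong (λ P → coeff P (m ∸ d)) (A≡sumOver-𝔖 (suc m)) ⟩
  coeff (sumOver (𝔖 (suc m)) (xpow ∘ desᴸ)) (m ∸ d)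
    ≡⟨ at (sumOver-complement m (xpow ∘ desᴸ)) (m ∸ d) ⟨
  coeff (sumOver (𝔖 (suc m)) (xpow ∘ desᴸ ∘ map (m ∸_))) (m ∸ d)
    ≡⟨ coeff-sumOver-cong (𝔖 (suc m)) _ _ (m ∸ d) d
                                                                        (λ l l∈ → reversed l (∈𝔖⇒IsPermutation l∈)) ⟩
  coeff (sumOver (𝔖 (suc m)) (xpow ∘ desᴸ)) d
    ≡⟨ cong (λ P → coeff P d) (A≡sumOver-𝔖 (suc m)) ⟨
  coeff (A (suc m)) d ∎
  where
  open ≡-Reasoning
  ∸-reflects-≟ : ∀ e → e ≤ m → does ((m ∸ e) ≟ℕ (m ∸ d)) ≡ does (e ≟ℕ d)
  ∸-reflects-≟ e e≤m with e ≟ℕ d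
  ... | yes e≡d = trans (≟-true (cong (m ∸_) e≡d)) (sym (≟-true e≡d))
  ... | no  e≢d = trans (≟-false {m ∸ e} {m ∸ d} (e≢d ∘ cancel)) (sym (≟-false e≢d))
    where
    cancel : m ∸ e ≡ m ∸ d → e ≡ d
    cancel e′ = trans (sym (m∸[m∸n]≡n e≤m)) (trans (cong (m ∸_) e′) (m∸[m∸n]≡n d≤m))
  reversed : ∀ l → IsPermutation (suc m) l → coeff (xpow (desᴸ (map (m ∸_) l))) (m ∸ d) ≡ coeff (xpow (desᴸ l)) d
  reversed l π@(u , bounded , len) = begin
    coeff (xpow (desᴸ (map (m ∸_) l))) (m ∸ d)  ≡⟨ cong (λ e → coeff (xpow e) (m ∸ d)) complement-des ⟩
    coeff (xpow (m ∸ desᴸ l)) (m ∸ d)           ≡⟨ coeff-xpow (m ∸ desᴸ l) (m ∸ d) ⟩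
    𝟙 (does ((m ∸ desᴸ l) ≟ℕ (m ∸ d)))          ≡⟨ cong 𝟙 (∸-reflects-≟ (desᴸ l) (desᴸ-< π)) ⟩
    𝟙 (does (desᴸ l ≟ℕ d))                      ≡⟨ coeff-xpow (desᴸ l) d ⟨
    coeff (xpow (desᴸ l)) d                     ∎
    where
    complement-des : desᴸ (map (m ∸_) l) ≡ m ∸ desᴸ l
    complement-des = trans (sym (m+n∸n≡m _ (desᴸ l)))
      (cong (_∸ desᴸ l) (trans (desᴸ-complement m l (All.map ≤-pred bounded) u) (cong (_∸ 1) len)))

p≋sumOver-𝔖 : ∀ m j → p m j ≋ sumOver (𝔖 (suc m)) (λ l → if does (nth l 0 ≟ℕ j) then xpow (desᴸ l) else [])
p≋sumOver-𝔖 m j =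
  ≋-trans (sumOver-filter (λ w → toℕ (Vec.lookup w Fin.zero) ≟ℕ j) (perms (suc m)) (xpow ∘ des))
  (≡⇒≋ (trans (sumOver-≡ (perms (suc m)) first-letter) (sym (sumOver-map oneLine (perms (suc m)) _))))
  where
  first-letter : ∀ (w : Vec (Fin (suc m)) (suc m)) →
    (if does (toℕ (Vec.lookup w Fin.zero) ≟ℕ j) then xpow (des w) else [])
      ≡ (if does (nth (oneLine w) 0 ≟ℕ j) then xpow (desᴸ (oneLine w)) else [])
  first-letter (a ∷ w) = cong (λ e → if does (toℕ a ≟ℕ j) then xpow e else []) (des-oneLine (a ∷ w))

p≋sumOver-insert : ∀ m h → h ≤ m → p m h ≋ sumOver (𝔖 m) (λ l → xpow (desᴸ (h ∷ map (punchIn h) l)))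
p≋sumOver-insert m h h≤m = ≋-trans (p≋sumOver-𝔖 m h) (≋-sym (sumOver-insert m 0 h z≤n h≤m (xpow ∘ desᴸ)))

desᴸ-punchIn-∷ : ∀ h c l → desᴸ (h ∷ map (punchIn h) (c ∷ l)) ≡ 𝟙 (c <ᵇ h) + desᴸ (c ∷ l)
desᴸ-punchIn-∷ h c l = cong₂ _+_ (cong 𝟙 first) (desᴸ-map (punchIn h) (punchIn-<ᵇ h) (c ∷ l))
  where
  first : (punchIn h c <ᵇ h) ≡ (c <ᵇ h)
  first with compare<ᵇ c h
  ... | lt _   e rewrite e = e
  ... | ge h≤c e rewrite e = <ᵇ-false (m≤n⇒m≤1+n h≤c)

p-initial : ∀ n → p n 0 ≋ A n
p-initial n = ≋-trans (p≋sumOver-insert n 0 z≤n)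
  (≡⇒≋ (trans (sumOver-≡ (𝔖 n) (cong xpow ∘ desᴸ-0∷)) (sym (A≡sumOver-𝔖 n))))
  where
  desᴸ-0∷ : ∀ l → desᴸ (0 ∷ map (punchIn 0) l) ≡ desᴸ l
  desᴸ-0∷ []      = refl
  desᴸ-0∷ (c ∷ l) = desᴸ-punchIn-∷ 0 c l

p-step : ∀ m j → j < m → p m (suc j) ⊕ p (m ∸ 1) j ≋ p m j ⊕ X ⊗ p (m ∸ 1) j
p-step (suc m) j (s≤s j≤m) = begin
  p (suc m) (suc j) ⊕ p m j
    ≈⟨ ⊕-cong (p≋sumOver-insert (suc m) (suc j) (s≤s j≤m)) (p≋sumOver-𝔖 m j) ⟩
  sumOver (𝔖 (suc m)) (first (suc j)) ⊕ sumOver (𝔖 (suc m)) starts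
    ≈⟨ sumOver-⊕ (𝔖 (suc m)) (first (suc j)) starts ⟨
  sumOver (𝔖 (suc m)) (λ l → first (suc j) l ⊕ starts l)
    ≈⟨ sumOver-cong (𝔖 (suc m)) (λ l l∈ → pointwise l (∈𝔖⇒IsPermutation l∈)) ⟩
  sumOver (𝔖 (suc m)) (λ l → first j l ⊕ X ⊗ starts l)
    ≈⟨ sumOver-⊕ (𝔖 (suc m)) (first j) (λ l → X ⊗ starts l) ⟩
  sumOver (𝔖 (suc m)) (first j) ⊕ sumOver (𝔖 (suc m)) (λ l → X ⊗ starts l)
    ≈⟨ ⊕-cong (p≋sumOver-insert (suc m) j (m≤n⇒m≤1+n j≤m))
              (≋-trans (X⊗-cong (p≋sumOver-𝔖 m j)) (X⊗-sumOver (𝔖 (suc m)) starts)) ⟨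
  p (suc m) j ⊕ X ⊗ p m j ∎
  where
  open ≋-Reasoning
  first : ℕ → List ℕ → Poly
  first h l = xpow (desᴸ (h ∷ map (punchIn h) l))
  starts : List ℕ → Poly
  starts l = if does (nth l 0 ≟ℕ j) then xpow (desᴸ l) else []
  pointwise : ∀ l → IsPermutation (suc m) l → first (suc j) l ⊕ starts l ≋ first j l ⊕ X ⊗ starts l
  pointwise (c ∷ l) _ rewrite desᴸ-punchIn-∷ (suc j) c l | desᴸ-punchIn-∷ j c l with c ≟ℕ j
  ... | yes refl rewrite ≟-true {c} refl | <ᵇ-true (n<1+n c) | <ᵇ-false (≤-refl {c}) = ⊕-comm (xpow (suc (desᴸ (c ∷ l)))) _
  ... | no  c≢j rewrite ≟-false c≢j =
    ⊕-cong (≡⇒≋ (cong (λ b → xpow (𝟙 b + desᴸ (c ∷ l))) same-side)) (≋-sym X⊗-zero)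
    where
    same-side : (c <ᵇ suc j) ≡ (c <ᵇ j)
    same-side with compare<ᵇ c j
    ... | lt c<j e rewrite e = <ᵇ-true (m≤n⇒m≤1+n c<j)
    ... | ge j≤c e rewrite e = <ᵇ-false (≤∧≢⇒< j≤c (λ j≡c → c≢j (sym j≡c)))

-- The polynomials q_{n,k}

Aᵒgo-distrib-⊕ : ∀ m P Q → Aᵒgo m (P ⊕ Q) ≋ Aᵒgo m P ⊕ Aᵒgo m Q
Aᵒgo-distrib-⊕ m []      Q       = ≋-refl
Aᵒgo-distrib-⊕ m (a ∷ P) []      = ≋-sym (⊕-identityʳ _)
Aᵒgo-distrib-⊕ m (a ∷ P) (b ∷ Q) =
  ≋-trans (⊕-cong (scale-distribʳ a b (Aᵒmono m)) (Aᵒgo-distrib-⊕ (suc m) P Q))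
          (⊕-interchange (scale a (Aᵒmono m)) (scale b (Aᵒmono m)) (Aᵒgo (suc m) P) (Aᵒgo (suc m) Q))

Aᵒgo-zero : ∀ m {P} → P ≋ [] → Aᵒgo m P ≋ []
Aᵒgo-zero m {[]}    _ = ≋-refl
Aᵒgo-zero m {a ∷ P} z =
  ⊕-cong (≋-trans (scale-congˡ (Aᵒmono m) (at z 0)) (scale-zero _)) (Aᵒgo-zero (suc m) {P} (mk≋ (at z ∘ suc)))

Aᵒgo-cong : ∀ m {P Q} → P ≋ Q → Aᵒgo m P ≋ Aᵒgo m Q
Aᵒgo-cong m {[]}    {Q}     e = ≋-sym (Aᵒgo-zero m (≋-sym e))
Aᵒgo-cong m {a ∷ P} {[]}    e = Aᵒgo-zero m e
Aᵒgo-cong m {a ∷ P} {b ∷ Q} e =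
  ⊕-cong (scale-congˡ (Aᵒmono m) (at e 0)) (Aᵒgo-cong (suc m) {P} {Q} (mk≋ (at e ∘ suc)))

Aᵒgo-shift : ∀ m a P → Aᵒgo m (shift a P) ≋ Aᵒgo (m + a) P
Aᵒgo-shift m zero    P rewrite +-identityʳ m = ≋-refl
Aᵒgo-shift m (suc a) P rewrite +-suc m a =
  ≋-trans (⊕-cong (scale-zero (Aᵒmono m)) (Aᵒgo-shift (suc m) a P)) ≋-refl

Aᵒgo-one : ∀ m → Aᵒgo m one ≋ Aᵒmono m
Aᵒgo-one m = ≋-trans (⊕-identityʳ _) (scale-one _)

Aᵒmono-degree : ∀ t → DegreeBelow (Aᵒmono t) (suc t)
Aᵒmono-degree zero    = DegreeBelow-∷ (mkDeg λ _ _ → refl)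
Aᵒmono-degree (suc t) = DegreeBelow-resp-≋ (X⊗≋∷ (A (suc t))) (DegreeBelow-∷ (A-degree t))

DegreeBelow-Aᵒgo : ∀ m {P} d → DegreeBelow P d → DegreeBelow (Aᵒgo m P) (m + d)
DegreeBelow-Aᵒgo m {[]}    d       _ = mkDeg λ _ _ → refl
DegreeBelow-Aᵒgo m {c ∷ P} zero    D =
  DegreeBelow-resp-≋ (Aᵒgo-zero m (mk≋ λ j → vanish D j z≤n)) (mkDeg λ _ _ → refl)
DegreeBelow-Aᵒgo m {c ∷ P} (suc d) D = subst (DegreeBelow (Aᵒgo m (c ∷ P))) (sym (+-suc m d))
  (DegreeBelow-⊕ (DegreeBelow-scale c (DegreeBelow-mono (s≤s (m≤m+n m d)) (Aᵒmono-degree m)))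
                 (DegreeBelow-Aᵒgo (suc m) {P} d (mkDeg λ j d≤j → vanish D (suc j) (s≤s d≤j))))

revTo≡tabulate : ∀ n P → revTo n P ≡ List.tabulate (λ (i : Fin (suc n)) → coeff P (n ∸ toℕ i))
revTo≡tabulate n P = trans (cong (map _) (toList-allFin (suc n))) (List.map-tabulate id _)

coeff-tabulate-< : ∀ m (h : ℕ → ℕ) i → i < m → coeff (List.tabulate {n = m} (h ∘ toℕ)) i ≡ h i
coeff-tabulate-< (suc m) h zero    _         = refl
coeff-tabulate-< (suc m) h (suc i) (s≤s i<m) = coeff-tabulate-< m (h ∘ suc) i i<m

coeff-tabulate-≥ : ∀ m (h : ℕ → ℕ) i → m ≤ i → coeff (List.tabulate {n = m} (h ∘ toℕ)) i ≡ 0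
coeff-tabulate-≥ zero    h i       _         = refl
coeff-tabulate-≥ (suc m) h (suc i) (s≤s m≤i) = coeff-tabulate-≥ m (h ∘ suc) i m≤i

coeff-revTo-≤ : ∀ n P i → i ≤ n → coeff (revTo n P) i ≡ coeff P (n ∸ i)
coeff-revTo-≤ n P i i≤n =
  trans (cong (λ L → coeff L i) (revTo≡tabulate n P)) (coeff-tabulate-< (suc n) (λ j → coeff P (n ∸ j)) i (s≤s i≤n))

coeff-revTo-> : ∀ n P i → n < i → coeff (revTo n P) i ≡ 0
coeff-revTo-> n P i n<i =
  trans (cong (λ L → coeff L i) (revTo≡tabulate n P)) (coeff-tabulate-≥ (suc n) (λ j → coeff P (n ∸ j)) i n<i)

revTo-≋ : ∀ n P {Q} → (∀ i → i ≤ n → coeff P (n ∸ i) ≡ coeff Q i) → (∀ i → n < i → coeff Q i ≡ 0) →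
          revTo n P ≋ Q
revTo-≋ n P below above = mk≋ λ i → case-≤ i (i ≤? n)
  where
  case-≤ : ∀ i → Dec (i ≤ n) → coeff (revTo n P) i ≡ _
  case-≤ i (yes i≤n) = trans (coeff-revTo-≤ n P i i≤n) (below i i≤n)
  case-≤ i (no  i≰n) = trans (coeff-revTo-> n P i (≰⇒> i≰n)) (sym (above i (≰⇒> i≰n)))

revTo-cong : ∀ n {P Q} → P ≋ Q → revTo n P ≋ revTo n Q
revTo-cong n {P} {Q} e =
  revTo-≋ n P (λ i i≤n → trans (at e (n ∸ i)) (sym (coeff-revTo-≤ n Q i i≤n))) (coeff-revTo-> n Q)

revTo-⊕ : ∀ n P Q → revTo n (P ⊕ Q) ≋ revTo n P ⊕ revTo n Q
revTo-⊕ n P Q = revTo-≋ n (P ⊕ Q)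
  (λ i i≤n → trans (coeff-⊕ P Q (n ∸ i)) (sym (trans (coeff-⊕ (revTo n P) (revTo n Q) i)
                                                      (cong₂ _+_ (coeff-revTo-≤ n P i i≤n) (coeff-revTo-≤ n Q i i≤n)))))
  (λ i n<i → trans (coeff-⊕ (revTo n P) (revTo n Q) i) (cong₂ _+_ (coeff-revTo-> n P i n<i) (coeff-revTo-> n Q i n<i)))

revTo-suc : ∀ n R → coeff R (suc n) ≡ 0 → revTo (suc n) R ≋ X ⊗ revTo n R
revTo-suc n R top≡0 = ≋-trans (revTo-≋ (suc n) R below above) (≋-sym (X⊗≋∷ (revTo n R)))
  where
  below : ∀ i → i ≤ suc n → coeff R (suc n ∸ i) ≡ coeff (0 ∷ revTo n R) i
  below zero    _         = top≡0
  below (suc i) (s≤s i≤n) = sym (coeff-revTo-≤ n R i i≤n)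
  above : ∀ i → suc n < i → coeff (0 ∷ revTo n R) i ≡ 0
  above (suc i) (s≤s n<i) = coeff-revTo-> n R i n<i

[1+X]^_ : ℕ → Poly
[1+X]^ k = ppow (1 ∷ 1 ∷ []) k

xpow-binom : ℕ → ℕ → Poly
xpow-binom a k = xpow a ⊗ [1+X]^ k

DegreeBelow-[1+X]^ : ∀ k → DegreeBelow ([1+X]^ k) (suc k)
DegreeBelow-[1+X]^ zero    = DegreeBelow-∷ (mkDeg λ _ _ → refl)
DegreeBelow-[1+X]^ (suc k) = DegreeBelow-resp-≋ (1+X⊗ ([1+X]^ k))
  (DegreeBelow-⊕ (DegreeBelow-mono (n≤1+n _) (DegreeBelow-[1+X]^ k)) (DegreeBelow-∷ (DegreeBelow-[1+X]^ k)))

DegreeBelow-xpow-binom : ∀ a k → DegreeBelow (xpow-binom a k) (suc (a + k))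
DegreeBelow-xpow-binom a k = DegreeBelow-resp-≋ (xpow⊗≋shift a ([1+X]^ k))
  (subst (DegreeBelow (shift a ([1+X]^ k))) (+-suc a k) (DegreeBelow-shift a (DegreeBelow-[1+X]^ k)))

xpow-binom-suc : ∀ a k → xpow-binom a (suc k) ≋ xpow-binom (suc a) k ⊕ xpow-binom a k
xpow-binom-suc a k = begin
  xpow a ⊗ [1+X]^ suc k
    ≈⟨ xpow⊗≋shift a ([1+X]^ suc k) ⟩
  shift a ((1 ∷ 1 ∷ []) ⊗ [1+X]^ k)
    ≈⟨ shift-cong a (1+X⊗ ([1+X]^ k)) ⟩
  shift a ([1+X]^ k ⊕ (0 ∷ [1+X]^ k))
    ≈⟨ shift-⊕ a ([1+X]^ k) (0 ∷ [1+X]^ k) ⟩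
  shift a ([1+X]^ k) ⊕ shift a (0 ∷ [1+X]^ k)
    ≈⟨ ⊕-comm (shift a ([1+X]^ k)) _ ⟩
  shift a (0 ∷ [1+X]^ k) ⊕ shift a ([1+X]^ k)
    ≈⟨ ⊕-cong (shift-∷0 a ([1+X]^ k)) ≋-refl ⟩
  shift (suc a) ([1+X]^ k) ⊕ shift a ([1+X]^ k) ≈⟨ ⊕-cong (xpow⊗≋shift (suc a) ([1+X]^ k)) (xpow⊗≋shift a ([1+X]^ k)) ⟨
  xpow-binom (suc a) k ⊕ xpow-binom a k ∎
  where open ≋-Reasoning

q-step : ∀ n k → k < n → q n (suc k) ≋ q n k ⊕ X ⊗ q (n ∸ 1) k
q-step (suc n) k (s≤s k≤n) = begin
  revTo (suc n) (Aᵒ (xpow-binom a (suc k)))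
    ≈⟨ revTo-cong (suc n) (Aᵒgo-cong 0 (xpow-binom-suc a k)) ⟩
  revTo (suc n) (Aᵒ (xpow-binom (suc a) k ⊕ xpow-binom a k))
    ≈⟨ revTo-cong (suc n) (Aᵒgo-distrib-⊕ 0 (xpow-binom (suc a) k) _) ⟩
  revTo (suc n) (Aᵒ (xpow-binom (suc a) k) ⊕ Aᵒ (xpow-binom a k))
    ≈⟨ revTo-⊕ (suc n) (Aᵒ (xpow-binom (suc a) k)) _ ⟩
  revTo (suc n) (Aᵒ (xpow-binom (suc a) k)) ⊕ revTo (suc n) (Aᵒ (xpow-binom a k))
    ≈⟨ ⊕-cong (≡⇒≋ (cong (λ b → revTo (suc n) (Aᵒ (xpow-binom b k))) (sym (+-∸-assoc 1 k≤n))))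
              (revTo-suc n (Aᵒ (xpow-binom a k)) top≡0) ⟩
  q (suc n) k ⊕ X ⊗ q n k ∎
  where
  open ≋-Reasoning
  a = n ∸ k
  top≡0 : coeff (Aᵒ (xpow-binom a k)) (suc n) ≡ 0
  top≡0 = vanish (DegreeBelow-Aᵒgo 0 _ (DegreeBelow-xpow-binom a k)) (suc n) (s≤s (≤-reflexive (m∸n+n≡m k≤n)))

q-initial : ∀ n → q n 0 ≋ A n
q-initial n = ≋-trans (revTo-cong n Aᵒ-xpow) (revTo-Aᵒmono n)
  where
  Aᵒ-xpow : Aᵒ (xpow n ⊗ one) ≋ Aᵒmono n
  Aᵒ-xpow = ≋-trans (Aᵒgo-cong 0 (xpow⊗≋shift n one)) (≋-trans (Aᵒgo-shift 0 n one) (Aᵒgo-one n))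
  -- x^n · (x A_n(1/x)) = A_n(x), by palindromicity.
  revTo-Aᵒmono : ∀ n → revTo n (Aᵒmono n) ≋ A n
  revTo-Aᵒmono zero    = mk≋ λ { zero → refl ; (suc i) → refl }
  revTo-Aᵒmono (suc m) =
    ≋-trans (revTo-cong (suc m) (X⊗≋∷ (A (suc m)))) (revTo-≋ (suc m) (0 ∷ A (suc m)) below above)
    where
    below : ∀ i → i ≤ suc m → coeff (0 ∷ A (suc m)) (suc m ∸ i) ≡ coeff (A (suc m)) i
    below i i≤1+m with m≤n⇒m<n∨m≡n i≤1+m
    ... | inj₁ (s≤s i≤m) = trans (cong (coeff (0 ∷ A (suc m))) (+-∸-assoc 1 i≤m)) (A-palindromic m i i≤m)
    ... | inj₂ refl      =
      trans (cong (coeff (0 ∷ A (suc m))) (n∸n≡0 (suc m))) (sym (vanish (A-degree m) (suc m) ≤-refl))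
    above : ∀ i → suc m < i → coeff (A (suc m)) i ≡ 0
    above i m<i = vanish (A-degree m) i (<⇒≤ m<i)

excᴸ-punchIn : ∀ h t l → h ≤ t → excᴸ (suc t) (map (punchIn h) l) ≡ excᴸ t l
excᴸ-punchIn h t []      _   = refl
excᴸ-punchIn h t (a ∷ l) h≤t = cong₂ _+_ (cong 𝟙 first) (excᴸ-punchIn h (suc t) l (m≤n⇒m≤1+n h≤t))
  where
  first : (suc t <ᵇ punchIn h a) ≡ (t <ᵇ a)
  first with compare<ᵇ a h
  ... | lt a<h e rewrite e | <ᵇ-false (≤-trans (<⇒≤ a<h) h≤t) = <ᵇ-false (≤-trans (<⇒≤ a<h) (m≤n⇒m≤1+n h≤t))
  ... | ge _   e rewrite e = refl

excᴸ-insertFixed : ∀ i p l → p ≤ length l → excᴸ i (insertAt p (i + p) (map (punchIn (i + p)) l)) ≡ excᴸ i l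
excᴸ-insertFixed i zero    l       _ rewrite +-identityʳ i | <ᵇ-false (≤-refl {i}) = excᴸ-punchIn i i l ≤-refl
excᴸ-insertFixed i (suc p) (a ∷ l) (s≤s p≤) rewrite +-suc i p =
  cong₂ _+_ (cong 𝟙 first) (excᴸ-insertFixed (suc i) p l p≤)
  where
  first : (i <ᵇ punchIn (suc (i + p)) a) ≡ (i <ᵇ a)
  first with compare<ᵇ a (suc (i + p))
  ... | lt _   e rewrite e = refl
  ... | ge i+p<a e rewrite e = trans (<ᵇ-true (m≤n⇒m≤1+n i<a)) (sym (<ᵇ-true i<a))
    where
    i<a : i < a
    i<a = ≤-trans (s≤s (m≤m+n i p)) i+p<a

fixᴸ-beyond : ∀ k t l → k ≤ t → fixᴸ k t l ≡ 0
fixᴸ-beyond k t []      _   = refl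
fixᴸ-beyond k t (a ∷ l) k≤t rewrite <ᵇ-false k≤t | ∧-zeroʳ (does (a ≟ℕ t)) =
  fixᴸ-beyond k (suc t) l (m≤n⇒m≤1+n k≤t)

fixᴸ-insertFixed : ∀ i p l → p ≤ length l →
                   fixᴸ (i + p) i (insertAt p (i + p) (map (punchIn (i + p)) l)) ≡ fixᴸ (i + p) i l
fixᴸ-insertFixed i zero    l       _ rewrite +-identityʳ i | <ᵇ-false (≤-refl {i}) | ∧-zeroʳ (does (i ≟ℕ i))
  = trans (fixᴸ-beyond i (suc i) (map (punchIn i) l) (n≤1+n i)) (sym (fixᴸ-beyond i i l ≤-refl))
fixᴸ-insertFixed i (suc p) (a ∷ l) (s≤s p≤) rewrite +-suc i p =
  cong₂ _+_ (cong (λ b → 𝟙 (b ∧ (i <ᵇ suc (i + p)))) first) (fixᴸ-insertFixed (suc i) p l p≤)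
  where
  first : does (punchIn (suc (i + p)) a ≟ℕ i) ≡ does (a ≟ℕ i)
  first with compare<ᵇ a (suc (i + p))
  ... | lt _      e rewrite e = refl
  ... | ge i+p<a e rewrite e = trans (≟-false (>⇒≢ (m≤n⇒m≤1+n i<a))) (sym (≟-false (>⇒≢ i<a)))
    where
    i<a : i < a
    i<a = ≤-trans (s≤s (m≤m+n i p)) i+p<a

fixᴸ-suc : ∀ i p l → p < length l → fixᴸ (suc (i + p)) i l ≡ fixᴸ (i + p) i l + 𝟙 (does (nth l p ≟ℕ i + p))
fixᴸ-suc i zero    (a ∷ l) _
  rewrite +-identityʳ i | <ᵇ-true (n<1+n i) | <ᵇ-false (≤-refl {i})
        | ∧-identityʳ (does (a ≟ℕ i)) | ∧-zeroʳ (does (a ≟ℕ i))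
        | fixᴸ-beyond (suc i) (suc i) l ≤-refl | fixᴸ-beyond i (suc i) l (n≤1+n i) = +-comm (𝟙 (does (a ≟ℕ i))) 0
fixᴸ-suc i (suc p) (a ∷ l) (s≤s p<) rewrite +-suc i p
  | <ᵇ-true (s≤s (m≤n⇒m≤1+n (m≤m+n i p))) | <ᵇ-true (s≤s (m≤m+n i p)) =
  trans (cong (𝟙 (does (a ≟ℕ i) ∧ true) +_) (fixᴸ-suc (suc i) p l p<))
        (sym (+-assoc (𝟙 (does (a ≟ℕ i) ∧ true)) _ _))

q-solves : SolvesRecurrence q
q-solves = record { initial = q-initial ; step = q-step }

-- The three formulas of part (b)

binomial-xA : ℕ → ℕ → Poly
binomial-xA n k = sumTo k (λ i → scale (k C i) (xpow i ⊗ A (n ∸ i)))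

binomial-xA-solves : SolvesRecurrence binomial-xA
binomial-xA-solves = record { initial = λ n → ≋-trans (scale-one _) (⊗-identityˡ (A n)) ; step = step }
  where
  step : ∀ n k → k < n → binomial-xA n (suc k) ≋ binomial-xA n k ⊕ X ⊗ binomial-xA (n ∸ 1) k
  step (suc n) k _ =
    ≋-trans (binomial-sum-pascal k (λ i → xpow i ⊗ A (suc n ∸ i)))
    (⊕-congʳ (binomial-xA (suc n) k) (≋-sym (≋-trans (X⊗-sumTo k _) (sumTo-cong k (λ i _ → raise i)))))
    where
    raise : ∀ i → X ⊗ scale (k C i) (xpow i ⊗ A (n ∸ i)) ≋ scale (k C i) (xpow (suc i) ⊗ A (n ∸ i))
    raise i =
      ≋-trans (X⊗-scale (k C i) (xpow i ⊗ A (n ∸ i))) (scale-congʳ (k C i) (≋-sym (X⊗-assoc (xpow i) (A (n ∸ i)))))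

fixed-exc-summand : ℕ → List ℕ → Poly
fixed-exc-summand k l = [1+X]^ (fixᴸ k 0 l) ⊗ xpow (excᴸ 0 l)

fixed-exc : ℕ → ℕ → Poly
fixed-exc n k = sumOver (𝔖 n) (fixed-exc-summand k)

sum-perms≡fixed-exc : ∀ n k →
  psum (map (λ w → ppow (one ⊕ X) (fixk k w) ⊗ xpow (exc w)) (perms n)) ≡ fixed-exc n k
sum-perms≡fixed-exc n k =
  trans (sumOver-≡ (perms n) (λ w → cong₂ (λ f e → [1+X]^ f ⊗ xpow e) (fixk-oneLine k w) (exc-oneLine w)))
        (sym (sumOver-map oneLine (perms n) (fixed-exc-summand k)))

[1+X]^suc-⊗xpow : ∀ f e → [1+X]^ (suc f) ⊗ xpow e ≋ [1+X]^ f ⊗ xpow e ⊕ X ⊗ ([1+X]^ f ⊗ xpow e)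
[1+X]^suc-⊗xpow f e = begin
  [1+X]^ (suc f) ⊗ xpow e
    ≈⟨ ⊗xpow≋shift ([1+X]^ suc f) e ⟩
  shift e ((1 ∷ 1 ∷ []) ⊗ [1+X]^ f)
    ≈⟨ shift-cong e (1+X⊗ ([1+X]^ f)) ⟩
  shift e ([1+X]^ f ⊕ (0 ∷ [1+X]^ f))
    ≈⟨ shift-⊕ e ([1+X]^ f) (0 ∷ [1+X]^ f) ⟩
  shift e ([1+X]^ f) ⊕ shift e (0 ∷ [1+X]^ f)
    ≈⟨ ⊕-cong (⊗xpow≋shift ([1+X]^ f) e) (≋-sym (shift-∷0 e ([1+X]^ f))) ⟨
  [1+X]^ f ⊗ xpow e ⊕ (0 ∷ shift e ([1+X]^ f))
    ≈⟨ ⊕-congʳ ([1+X]^ f ⊗ xpow e) (∷-cong refl (⊗xpow≋shift ([1+X]^ f) e)) ⟨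
  [1+X]^ f ⊗ xpow e ⊕ (0 ∷ [1+X]^ f ⊗ xpow e)
    ≈⟨ ⊕-congʳ ([1+X]^ f ⊗ xpow e) (X⊗≋∷ ([1+X]^ f ⊗ xpow e)) ⟨
  [1+X]^ f ⊗ xpow e ⊕ X ⊗ ([1+X]^ f ⊗ xpow e) ∎
  where open ≋-Reasoning

fixed-exc-summand-suc : ∀ k l → k < length l →
  fixed-exc-summand (suc k) l
    ≋ fixed-exc-summand k l ⊕ X ⊗ (if does (nth l k ≟ℕ k) then fixed-exc-summand k l else [])
fixed-exc-summand-suc k l k<l rewrite fixᴸ-suc 0 k l k<l with does (nth l k ≟ℕ k)
... | true  rewrite +-comm (fixᴸ k 0 l) 1 = [1+X]^suc-⊗xpow (fixᴸ k 0 l) (excᴸ 0 l)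
... | false rewrite +-identityʳ (fixᴸ k 0 l) =
  ≋-sym (≋-trans (⊕-congʳ (fixed-exc-summand k l) X⊗-zero) (⊕-identityʳ _))

fixed-exc-summand-insertFixed : ∀ k l → k ≤ length l →
  fixed-exc-summand k (insertAt k k (map (punchIn k) l)) ≡ fixed-exc-summand k l
fixed-exc-summand-insertFixed k l k≤l =
  cong₂ (λ f e → [1+X]^ f ⊗ xpow e) (fixᴸ-insertFixed 0 k l k≤l) (excᴸ-insertFixed 0 k l k≤l)

fixed-exc-solves : SolvesRecurrence fixed-exc
fixed-exc-solves = record { initial = initial ; step = step }
  where
  initial : ∀ n → fixed-exc n 0 ≋ A n
  initial n = begin
    sumOver (𝔖 n) (fixed-exc-summand 0)  ≈⟨ sumOver-cong (𝔖 n) (λ l _ → no-fixed l) ⟩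
    sumOver (𝔖 n) (xpow ∘ excᴸ 0)        ≈⟨ exc-des-equidistributed n xpow ⟩
    sumOver (𝔖 n) (xpow ∘ desᴸ)          ≡⟨ A≡sumOver-𝔖 n ⟨
    A n                                  ∎
    where
    open ≋-Reasoning
    no-fixed : ∀ l → fixed-exc-summand 0 l ≋ xpow (excᴸ 0 l)
    no-fixed l rewrite fixᴸ-beyond 0 0 l z≤n = ⊗-identityˡ (xpow (excᴸ 0 l))
  step : ∀ n k → k < n → fixed-exc n (suc k) ≋ fixed-exc n k ⊕ X ⊗ fixed-exc (n ∸ 1) k
  step (suc m) k (s≤s k≤m) = begin
    sumOver (𝔖 (suc m)) (fixed-exc-summand (suc k))
      ≈⟨ sumOver-cong (𝔖 (suc m)) (λ l l∈ → split l (∈𝔖⇒IsPermutation l∈)) ⟩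
    sumOver (𝔖 (suc m)) (λ l → fixed-exc-summand k l ⊕ X ⊗ fixes-k l)
      ≈⟨ sumOver-⊕ (𝔖 (suc m)) (fixed-exc-summand k) (λ l → X ⊗ fixes-k l) ⟩
    fixed-exc (suc m) k ⊕ sumOver (𝔖 (suc m)) (λ l → X ⊗ fixes-k l)
      ≈⟨ ⊕-congʳ (fixed-exc (suc m) k) (X⊗-sumOver (𝔖 (suc m)) fixes-k) ⟨
    fixed-exc (suc m) k ⊕ X ⊗ sumOver (𝔖 (suc m)) fixes-k
      ≈⟨ ⊕-congʳ (fixed-exc (suc m) k) (X⊗-cong (sumOver-insert m k k k≤m k≤m (fixed-exc-summand k))) ⟨
    fixed-exc (suc m) k ⊕ X ⊗ sumOver (𝔖 m) (λ l → fixed-exc-summand k (insertAt k k (map (punchIn k) l)))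
      ≈⟨ ⊕-congʳ (fixed-exc (suc m) k) (X⊗-cong (sumOver-cong (𝔖 m) λ l l∈ → ≡⇒≋ (insert-k l (∈𝔖⇒IsPermutation l∈)))) ⟩
    fixed-exc (suc m) k ⊕ X ⊗ fixed-exc m k ∎
    where
    open ≋-Reasoning
    fixes-k : List ℕ → Poly
    fixes-k l = if does (nth l k ≟ℕ k) then fixed-exc-summand k l else []
    split : ∀ l → IsPermutation (suc m) l → fixed-exc-summand (suc k) l ≋ fixed-exc-summand k l ⊕ X ⊗ fixes-k l
    split l (_ , _ , len) = fixed-exc-summand-suc k l (subst (k <_) (sym len) (s≤s k≤m))
    insert-k : ∀ l → IsPermutation m l → fixed-exc-summand k (insertAt k k (map (punchIn k) l)) ≡ fixed-exc-summand k l
    insert-k l (_ , _ , len) = fixed-exc-summand-insertFixed k l (subst (k ≤_) (sym len) k≤m)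

binomial-p : ℕ → ℕ → Poly
binomial-p n k = sumTo k (λ i → scale (k C i) (p (n ∸ i) (k ∸ i)))

binomial-p-solves : SolvesRecurrence binomial-p
binomial-p-solves = record { initial = λ n → ≋-trans (scale-one _) (p-initial n) ; step = step }
  where
  step : ∀ n k → k < n → binomial-p n (suc k) ≋ binomial-p n k ⊕ X ⊗ binomial-p (n ∸ 1) k
  step (suc n) k (s≤s k≤n) = begin
    binomial-p (suc n) (suc k)
      ≈⟨ binomial-sum-pascal k (λ i → p (suc n ∸ i) (suc k ∸ i)) ⟩
    sumTo k (λ i → scale (k C i) (p (suc n ∸ i) (suc k ∸ i))) ⊕ sumTo k (λ i → scale (k C i) (p (n ∸ i) (k ∸ i)))
      ≈⟨ sumTo-⊕ k _ _ ⟨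
    sumTo k (λ i → scale (k C i) (p (suc n ∸ i) (suc k ∸ i)) ⊕ scale (k C i) (p (n ∸ i) (k ∸ i)))
      ≈⟨ sumTo-cong k termwise ⟩
    sumTo k (λ i → scale (k C i) (p (suc n ∸ i) (k ∸ i)) ⊕ X ⊗ scale (k C i) (p (n ∸ i) (k ∸ i)))
      ≈⟨ sumTo-⊕ k _ _ ⟩
    binomial-p (suc n) k ⊕ sumTo k (λ i → X ⊗ scale (k C i) (p (n ∸ i) (k ∸ i)))
      ≈⟨ ⊕-congʳ (binomial-p (suc n) k) (X⊗-sumTo k _) ⟨
    binomial-p (suc n) k ⊕ X ⊗ binomial-p n k
      ∎
    where
    open ≋-Reasoning
    shifted-p-step : ∀ i → i ≤ k →
      p (suc n ∸ i) (suc k ∸ i) ⊕ p (n ∸ i) (k ∸ i) ≋ p (suc n ∸ i) (k ∸ i) ⊕ X ⊗ p (n ∸ i) (k ∸ i)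
    shifted-p-step i i≤k rewrite +-∸-assoc 1 i≤k | +-∸-assoc 1 (≤-trans i≤k k≤n) =
      p-step (suc (n ∸ i)) (k ∸ i) (s≤s (∸-monoˡ-≤ i k≤n))
    termwise : ∀ i → i ≤ k → scale (k C i) (p (suc n ∸ i) (suc k ∸ i)) ⊕ scale (k C i) (p (n ∸ i) (k ∸ i))
                              ≋ scale (k C i) (p (suc n ∸ i) (k ∸ i)) ⊕ X ⊗ scale (k C i) (p (n ∸ i) (k ∸ i))
    termwise i i≤k = begin
      scale c (p (suc n ∸ i) (suc k ∸ i)) ⊕ scale c (p (n ∸ i) (k ∸ i))
        ≈⟨ scale-distribˡ c (p (suc n ∸ i) (suc k ∸ i)) (p (n ∸ i) (k ∸ i)) ⟨
      scale c (p (suc n ∸ i) (suc k ∸ i) ⊕ p (n ∸ i) (k ∸ i))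
        ≈⟨ scale-congʳ c (shifted-p-step i i≤k) ⟩
      scale c (p (suc n ∸ i) (k ∸ i) ⊕ X ⊗ p (n ∸ i) (k ∸ i))
        ≈⟨ scale-distribˡ c (p (suc n ∸ i) (k ∸ i)) (X ⊗ p (n ∸ i) (k ∸ i)) ⟩
      scale c (p (suc n ∸ i) (k ∸ i)) ⊕ scale c (X ⊗ p (n ∸ i) (k ∸ i))
        ≈⟨ ⊕-congʳ (scale c (p (suc n ∸ i) (k ∸ i))) (X⊗-scale c (p (n ∸ i) (k ∸ i))) ⟨
      scale c (p (suc n ∸ i) (k ∸ i)) ⊕ X ⊗ scale c (p (n ∸ i) (k ∸ i)) ∎
      where c = k C i

proposition3p1 : (∀ (n k : ℕ) → k < n → q n (suc k) ≈ q n k ⊕ X ⊗ q (n ∸ 1) k)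
    × (∀ (n k : ℕ) → k ≤ n →
    (q n k ≈ sumTo k (λ i → scale (k C i) (xpow i ⊗ A (n ∸ i))))
    × (q n k ≈ psum (map (λ w → ppow (one ⊕ X) (fixk k w) ⊗ xpow (exc w)) (perms n)))
    × (q n k ≈ sumTo k (λ i → scale (k C i) (p (n ∸ i) (k ∸ i)))))
proposition3p1 =
  (λ n k k<n → at (q-step n k k<n)) ,
  (λ n k k≤n → at (agree binomial-xA-solves n k k≤n) ,
               subst (q n k ≈_) (sym (sum-perms≡fixed-exc n k)) (at (agree fixed-exc-solves n k k≤n)) ,
               at (agree binomial-p-solves n k k≤n))
  where
  agree : ∀ {T} → SolvesRecurrence T → ∀ n k → k ≤ n → q n k ≋ T n k
  agree = recurrence-unique q-solves
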